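{- Suppose $\Gamma\vdash w:A$ is derivable in $\mathsf{HA}+\mathsf{NEM}$, where $\Gamma=x_1:A_1,\dots,x_n:A_n,\Delta$ with $\Delta$ containing no declarations of proof-term variables, and the free variables of the formulas occurring in $\Gamma$ and $A$ are among $\alpha_1,\dots,\alpha_k$. Then for all terms $r_1,\dots,r_k$ of $\mathcal{L}$ and all untyped proof terms $t_1,\dots,t_n$ such that $t_i\Vdash A_i[r_1/\alpha_1\cdots r_k/\alpha_k]$ for $i=1,\dots,n$, we have $w[t_1/x_1\cdots t_n/x_n\ r_1/\alpha_1\cdots r_k/\alpha_k]\Vdash A[r_1/\alpha_1\cdots r_k/\alpha_k]$.
   Context: Terms of the arithmetical language $\mathcal{L}$ are built from numeric variables $\alpha,\beta,\dots$, $0$ and $\mathsf{S}$; a numeral is a closed term $\mathsf{S}\cdots\mathsf{S}0$. There is a predicate symbol for every primitive recursive relation on $\mathbb{N}$ (including $=$ and the false $0$-ary relation $\bot$); atomic formulas $\mathsf{P}$ are such symbols applied to terms; for atomic $\mathsf{P}$, $\lnot\mathsf{P}$ denotes the atomic formula of the boolean negation of $\mathsf{P}$. Formulas are built from atomic formulas by $\wedge,\vee,\rightarrow,\forall\alpha^{\mathbb N},\exists\alpha^{\mathbb N}$. Untyped proof terms of $\mathsf{HA}+\mathsf{NEM}$: $t,u,v ::= x \mid tu \mid tm \mid \lambda x\, u \mid \lambda\alpha\, u \mid \langle t,u\rangle \mid \pi_0 u \mid \pi_1 u \mid \mathsf{inj}_0(u)\mid \mathsf{inj}_1(u) \mid t[x.u,y.v]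 \mid (m,t) \mid t[(\alpha,x).u] \mid \mathsf{E}(u,v) \mid \mathsf{H}^{\mathsf P}_\alpha \mid \mathsf{W}^{\mathsf P}_\alpha \mid \mathsf{True} \mid \mathsf{R}\,u\,v\,m \mid \mathsf{r}\,t_1\dots t_n$, with $m$ terms of $\mathcal{L}$, $x,y$ proof-term variables, $\mathsf{r}$ a constant. Contexts $\Gamma$ are lists $e_1:A_1,\dots,e_n:A_n$ of distinct variables, each $e_i$ a proof-term variable or a hypothesis variable $a,b,\dots$. Typing rules of $\mathsf{HA}+\mathsf{NEM}$: $\Gamma,x:A\vdash x:A$; $\Gamma,a:\forall\alpha^{\mathbb N}\mathsf{P}\vdash \mathsf{H}^{\mathsf P}_\alpha:\forall\alpha^{\mathbb N}\mathsf P$; $\Gamma,a:\exists\alpha^{\mathbb N}\lnot\mathsf P\vdash\mathsf{W}^{\mathsf P}_\alpha:\exists\alpha^{\mathbb N}\lnot\mathsf P$; from $\Gamma\vdash u:A$, $\Gamma\vdash t:B$ infer $\Gamma\vdash\langle u,t\rangle:A\wedge B$; from $\Gamma\vdash u:A\wedge B$ infer $\Gamma\vdash\pi_0u:A$ and $\Gamma\vdash\pi_1u:B$; from $\Gamma\vdash t:A\rightarrow B$, $\Gamma\vdash u:A$ infer $\Gamma\vdash tu:B$; from $\Gamma,x:A\vdash u:B$ infer $\Gamma\vdash\lambda x\,u:A\rightarrow B$; from $\Gamma\vdash u:A$ infer $\Gamma\vdash\mathsf{inj}_0(u):A\vee B$, from $\Gamma\vdash u:B$ infer $\Gamma\vdash\mathsf{inj}_1(u):A\vee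 B$; from $\Gamma\vdash u:A\vee B$, $\Gamma,x:A\vdash w_1:C$, $\Gamma,x:B\vdash w_2:C$ infer $\Gamma\vdash u[x.w_1,x.w_2]:C$; from $\Gamma\vdash u:\forall\alpha^{\mathbb N}A$ infer $\Gamma\vdash um:A[m/\alpha]$ ($m$ term of $\mathcal L$); from $\Gamma\vdash u:A$ infer $\Gamma\vdash\lambda\alpha\,u:\forall\alpha^{\mathbb N}A$ if $\alpha$ is not free in any formula of $\Gamma$; from $\Gamma\vdash u:A[m/\alpha]$ infer $\Gamma\vdash(m,u):\exists\alpha^{\mathbb N}A$; from $\Gamma\vdash u:\exists\alpha^{\mathbb N}A$, $\Gamma,x:A\vdash t:C$ infer $\Gamma\vdash u[(\alpha,x).t]:C$ if $\alpha$ is not free in $C$ nor in any formula of $\Gamma$; from $\Gamma\vdash u:A(0)$, $\Gamma\vdash v:\forall\alpha^{\mathbb N}(A(\alpha)\rightarrow A(\mathsf S\alpha))$ infer $\Gamma\vdash\mathsf{R}uvt:A(t)$ for any term $t$ of $\mathcal L$; Post rules: from $\Gamma\vdash u_i:\mathsf{P}_i$ ($i=1..n$) infer $\Gamma\vdash u:\mathsf P$, where $\mathsf P_1,\dots,\mathsf P_n,\mathsf P$ are atomic and every substitution of closed terms making all $\mathsf P_i$ true makes $\mathsf P$ true (these include equality axioms, Peano axioms and defining axioms of primitive recursive relations), with $u=\mathsf{r}u_1\dots u_n$ if $n>0$ and $u=\mathsf{True}$ if $n=0$; $\mathsf{NEM}$: from $\Gamma,a:\forall\alpha^{\mathbb N}\mathsf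 P\vdash w_1:C$ and $\Gamma,a:\exists\alpha^{\mathbb N}\lnot\mathsf P\vdash w_2:C$ infer $\Gamma\vdash\mathsf{E}(w_1,w_2):C$. The one-step reduction $\leadsto$ is the closure under all term contexts of: $(\lambda x.u)t\leadsto u[t/x]$; $(\lambda\alpha.u)t\leadsto u[t/\alpha]$ ($t$ term of $\mathcal L$); $\pi_i\langle u_0,u_1\rangle\leadsto u_i$; $\mathsf{inj}_i(u)[x_0.t_0,x_1.t_1]\leadsto t_i[u/x_i]$; $(n,u)[(\alpha,x).v]\leadsto v[n/\alpha][u/x]$ ($n$ numeral); $\mathsf{R}uv0\leadsto u$; $\mathsf{R}uv(\mathsf{S}n)\leadsto vn(\mathsf{R}uvn)$ ($n$ numeral); $(\mathsf{E}(u,v))w\leadsto \mathsf{E}(uw,vw)$; $\pi_i(\mathsf{E}(u,v))\leadsto\mathsf{E}(\pi_iu,\pi_iv)$; $(\mathsf{E}(u,v))[x.w_1,y.w_2]\leadsto\mathsf{E}(u[x.w_1,y.w_2],v[x.w_1,y.w_2])$; $(\mathsf{E}(u,v))[(\alpha,x).w]\leadsto\mathsf{E}(u[(\alpha,x).w],v[(\alpha,x).w])$; $\mathsf{H}^{\mathsf P}_\alpha n\leadsto\mathsf{True}$ if $\mathsf{P}[n/\alpha]$ is true; $\mathsf{W}^{\mathsf P}_\alpha\leadsto(n,\mathsf{True})$ for every numeral $n$; $\mathsf{E}(u,v)\leadsto u$; $\mathsf{E}(u,v)\leadsto v$. $\leadsto^{*}$ is its reflexive-transitive closure; $\mathsf{SN}$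 is the set of untyped terms admitting no infinite $\leadsto$-reduction sequence. Reducibility $t\Vdash C$ is defined by induction on $C$: $t\Vdash\mathsf{P}$ ($\mathsf P$ atomic) iff $t\in\mathsf{SN}$; $t\Vdash A\wedge B$ iff $\pi_0t\Vdash A$ and $\pi_1t\Vdash B$; $t\Vdash A\rightarrow B$ iff for all $u\Vdash A$, $tu\Vdash B$; $t\Vdash A\vee B$ iff $t\in\mathsf{SN}$ and $t\leadsto^{*}\mathsf{inj}_0(u)$ implies $u\Vdash A$ and $t\leadsto^{*}\mathsf{inj}_1(u)$ implies $u\Vdash B$; $t\Vdash\forall\alpha^{\mathbb N}A$ iff for every term $n$ of $\mathcal L$, $tn\Vdash A[n/\alpha]$; $t\Vdash\exists\alpha^{\mathbb N}A$ iff $t\in\mathsf{SN}$ and for every term $n$ of $\mathcal L$, $t\leadsto^{*}(n,u)$ implies $u\Vdash A[n/\alpha]$. -}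

module Defs where

open import Data.Nat using (ℕ; zero; suc; _<?_; _<_)
open import Data.Fin using (Fin; fromℕ<)
open import Data.Vec using (Vec; []; _∷_; lookup; toList)
import Data.Vec as V
open import Data.List using (List; []; _∷_; map; _++_)
open import Data.Bool using (Bool; true; false; not)
open import Data.Maybe using (Maybe; just; nothing)
open import Data.Product using (Σ; _×_; _,_)
open import Data.Unit using (⊤)
open import Function using (_∘_)
open import Relation.Binary.PropositionalEquality using (_≡_)
open import Relation.Nullary using (¬_; yes; no)
open import Data.List.Relation.Unary.All using (All)
open import Data.List.Relation.Binary.Pointwise using (Pointwise)
open import Data.List.Membership.Propositional using (_∈_)
open import Relation.Binary.Construct.Closure.ReflexiveTransitive using (Star)

data PR : ℕ → Set where
  Zf : ∀ {n} → PR n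
  Sf : PR 1
  Pf : ∀ {n} → Fin n → PR n
  Cf : ∀ {m n} → PR m → Vec (PR n) m → PR n
  Rf : ∀ {n} → PR n → PR (suc (suc n)) → PR (suc n)

mutual
  evalPR : ∀ {n} → PR n → Vec ℕ n → ℕ
  evalPR Zf xs = 0
  evalPR Sf (x ∷ []) = suc x
  evalPR (Pf i) xs = lookup xs i
  evalPR (Cf f gs) xs = evalPR f (evalPRs gs xs)
  evalPR (Rf f g) (y ∷ xs) = evalRec f g y xs

  evalPRs : ∀ {m n} → Vec (PR n) m → Vec ℕ n → Vec ℕ m
  evalPRs [] xs = []
  evalPRs (g ∷ gs) xs = evalPR g xs ∷ evalPRs gs xs

  evalRec : ∀ {n} → PR n → PR (suc (suc n)) → ℕ → Vec ℕ n → ℕ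
  evalRec f g zero xs = evalPR f xs
  evalRec f g (suc y) xs = evalPR g (y ∷ evalRec f g y xs ∷ xs)

-- A predicate symbol of arity n: a primitive recursive relation, given by
-- a primitive recursive characteristic code χ (relation holds iff χ(x) = 0)
-- together with a polarity (false = the boolean negation of that relation).
-- Every primitive recursive relation (in particular =, and the 0-ary ⊥)
-- has such a symbol.
record PSym (n : ℕ) : Set where
  constructor psym
  field
    code : PR n
    pol  : Bool

Holds : ∀ {n} → PSym n → Vec ℕ n → Set
Holds (psym χ true)  xs = evalPR χ xs ≡ 0
Holds (psym χ false) xs = ¬ (evalPR χ xs ≡ 0)

data Tm : Set where
  vr  : ℕ → Tm
  𝟎   : Tm
  𝐒   : Tm → Tm

num : ℕ → Tm
num zero = 𝟎
num (suc n) = 𝐒 (num n)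

data IsNum : Tm → Set where
  num𝟎 : IsNum 𝟎
  num𝐒 : ∀ {m} → IsNum m → IsNum (𝐒 m)

record Atom : Set where
  constructor _⦅_⦆
  field
    {ar}  : ℕ
    sym   : PSym ar
    args  : Vec Tm ar

negA : Atom → Atom
negA (psym χ b ⦅ ts ⦆) = psym χ (not b) ⦅ ts ⦆

-- formulas; ∀' and ∃' bind numeric de Bruijn index 0
data Fm : Set where
  atm  : Atom → Fm
  _∧'_ : Fm → Fm → Fm
  _∨'_ : Fm → Fm → Fm
  _⇒_  : Fm → Fm → Fm
  ∀'   : Fm → Fm
  ∃'   : Fm → Fm

Sub : Set
Sub = ℕ → Tm

substT : Sub → Tm → Tm
substT σ (vr i) = σ i
substT σ 𝟎 = 𝟎
substT σ (𝐒 t) = 𝐒 (substT σ t)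

shiftT : Tm → Tm
shiftT = substT (vr ∘ suc)

liftS : Sub → Sub
liftS σ zero = vr zero
liftS σ (suc i) = shiftT (σ i)

substA : Sub → Atom → Atom
substA σ (s ⦅ ts ⦆) = s ⦅ V.map (substT σ) ts ⦆

substF : Sub → Fm → Fm
substF σ (atm P) = atm (substA σ P)
substF σ (A ∧' B) = substF σ A ∧' substF σ B
substF σ (A ∨' B) = substF σ A ∨' substF σ B
substF σ (A ⇒ B) = substF σ A ⇒ substF σ B
substF σ (∀' A) = ∀' (substF (liftS σ) A)
substF σ (∃' A) = ∃' (substF (liftS σ) A)

single : Tm → Sub
single m zero = m
single m (suc i) = vr i

_[_]F : Fm → Tm → Fm
A [ m ]F = substF (single m) A

shiftF : Fm → Fm
shiftF = substF (vr ∘ suc)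

-- A(Sα) from A(α), α being index 0
stepS : Sub
stepS zero = 𝐒 (vr zero)
stepS (suc i) = vr (suc i)

-- truth of an atomic formula: all argument terms closed, relation holds
evalTm : Tm → Maybe ℕ
evalTm (vr _) = nothing
evalTm 𝟎 = just 0
evalTm (𝐒 t) with evalTm t
... | just n = just (suc n)
... | nothing = nothing

evalTms : ∀ {n} → Vec Tm n → Maybe (Vec ℕ n)
evalTms [] = just []
evalTms (t ∷ ts) with evalTm t | evalTms ts
... | just n | just ns = just (n ∷ ns)
... | _ | _ = nothing

TrueA : Atom → Set
TrueA (s ⦅ ts ⦆) = Σ _ λ ns → (evalTms ts ≡ just ns) × Holds s ns

PostValid : List Atom → Atom → Set
PostValid Ps P = (ρ : ℕ → ℕ) →
  All (λ Q → TrueA (substA (num ∘ ρ) Q)) Ps → TrueA (substA (num ∘ ρ) P)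

data PT : Set where
  pv   : ℕ → PT
  _·_  : PT → PT → PT
  _·ₙ_ : PT → Tm → PT
  ƛ_   : PT → PT                -- λx u       (binds proof var 0)
  Λ_   : PT → PT                -- λα u       (binds numeric var 0)
  ⟨_,_⟩ : PT → PT → PT
  π₀   : PT → PT
  π₁   : PT → PT
  inj₀ : PT → PT
  inj₁ : PT → PT
  case : PT → PT → PT → PT      -- t[x.u, y.v] (u, v bind proof var 0)
  ⟪_,_⟫ : Tm → PT → PT
  exE  : PT → PT → PT           -- t[(α,x).u] (u binds numeric 0 and proof 0)
  Em   : PT → PT → PT
  Hyp  : Atom → PT              -- H^P_α  (α = numeric index 0 of P)
  Wit  : Atom → PT              -- W^P_α  (α = numeric index 0 of P)
  TT   : PT
  Rec  : PT → PT → Tm → PT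
  rc   : List PT → PT

mutual
  substNP : Sub → PT → PT
  substNP σ (pv x) = pv x
  substNP σ (t · u) = substNP σ t · substNP σ u
  substNP σ (t ·ₙ m) = substNP σ t ·ₙ substT σ m
  substNP σ (ƛ u) = ƛ substNP σ u
  substNP σ (Λ u) = Λ substNP (liftS σ) u
  substNP σ ⟨ t , u ⟩ = ⟨ substNP σ t , substNP σ u ⟩
  substNP σ (π₀ t) = π₀ (substNP σ t)
  substNP σ (π₁ t) = π₁ (substNP σ t)
  substNP σ (inj₀ t) = inj₀ (substNP σ t)
  substNP σ (inj₁ t) = inj₁ (substNP σ t)
  substNP σ (case t u v) = case (substNP σ t) (substNP σ u) (substNP σ v)
  substNP σ ⟪ m , t ⟫ = ⟪ substT σ m , substNP σ t ⟫
  substNP σ (exE t u) = exE (substNP σ t) (substNP (liftS σ) u)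
  substNP σ (Em t u) = Em (substNP σ t) (substNP σ u)
  substNP σ (Hyp P) = Hyp (substA (liftS σ) P)
  substNP σ (Wit P) = Wit (substA (liftS σ) P)
  substNP σ TT = TT
  substNP σ (Rec t u m) = Rec (substNP σ t) (substNP σ u) (substT σ m)
  substNP σ (rc ts) = rc (substNPs σ ts)

  substNPs : Sub → List PT → List PT
  substNPs σ [] = []
  substNPs σ (t ∷ ts) = substNP σ t ∷ substNPs σ ts

shiftNP : PT → PT
shiftNP = substNP (vr ∘ suc)

liftR : (ℕ → ℕ) → ℕ → ℕ
liftR ρ zero = zero
liftR ρ (suc i) = suc (ρ i)

mutual
  renP : (ℕ → ℕ) → PT → PT
  renP ρ (pv x) = pv (ρ x)
  renP ρ (t · u) = renP ρ t · renP ρ u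
  renP ρ (t ·ₙ m) = renP ρ t ·ₙ m
  renP ρ (ƛ u) = ƛ renP (liftR ρ) u
  renP ρ (Λ u) = Λ renP ρ u
  renP ρ ⟨ t , u ⟩ = ⟨ renP ρ t , renP ρ u ⟩
  renP ρ (π₀ t) = π₀ (renP ρ t)
  renP ρ (π₁ t) = π₁ (renP ρ t)
  renP ρ (inj₀ t) = inj₀ (renP ρ t)
  renP ρ (inj₁ t) = inj₁ (renP ρ t)
  renP ρ (case t u v) = case (renP ρ t) (renP (liftR ρ) u) (renP (liftR ρ) v)
  renP ρ ⟪ m , t ⟫ = ⟪ m , renP ρ t ⟫
  renP ρ (exE t u) = exE (renP ρ t) (renP (liftR ρ) u)
  renP ρ (Em t u) = Em (renP ρ t) (renP ρ u)
  renP ρ (Hyp P) = Hyp P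
  renP ρ (Wit P) = Wit P
  renP ρ TT = TT
  renP ρ (Rec t u m) = Rec (renP ρ t) (renP ρ u) m
  renP ρ (rc ts) = rc (renPs ρ ts)

  renPs : (ℕ → ℕ) → List PT → List PT
  renPs ρ [] = []
  renPs ρ (t ∷ ts) = renP ρ t ∷ renPs ρ ts

PSub : Set
PSub = ℕ → PT

liftP : PSub → PSub
liftP τ zero = pv zero
liftP τ (suc i) = renP suc (τ i)

liftNP : PSub → PSub
liftNP τ i = shiftNP (τ i)

mutual
  substP : PSub → PT → PT
  substP τ (pv x) = τ x
  substP τ (t · u) = substP τ t · substP τ u
  substP τ (t ·ₙ m) = substP τ t ·ₙ m
  substP τ (ƛ u) = ƛ substP (liftP τ) u
  substP τ (Λ u) = Λ substP (liftNP τ) u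
  substP τ ⟨ t , u ⟩ = ⟨ substP τ t , substP τ u ⟩
  substP τ (π₀ t) = π₀ (substP τ t)
  substP τ (π₁ t) = π₁ (substP τ t)
  substP τ (inj₀ t) = inj₀ (substP τ t)
  substP τ (inj₁ t) = inj₁ (substP τ t)
  substP τ (case t u v) = case (substP τ t) (substP (liftP τ) u) (substP (liftP τ) v)
  substP τ ⟪ m , t ⟫ = ⟪ m , substP τ t ⟫
  substP τ (exE t u) = exE (substP τ t) (substP (liftP (liftNP τ)) u)
  substP τ (Em t u) = Em (substP τ t) (substP τ u)
  substP τ (Hyp P) = Hyp P
  substP τ (Wit P) = Wit P
  substP τ TT = TT
  substP τ (Rec t u m) = Rec (substP τ t) (substP τ u) m
  substP τ (rc ts) = rc (substPs τ ts)

  substPs : PSub → List PT → List PT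
  substPs τ [] = []
  substPs τ (t ∷ ts) = substP τ t ∷ substPs τ ts

singleP : PT → PSub
singleP t zero = t
singleP t (suc i) = pv i

_[_]P : PT → PT → PT
u [ t ]P = substP (singleP t) u

infix 4 _⇝_ _⇝ₗ_ _⇝*_

data _⇝_ : PT → PT → Set
data _⇝ₗ_ : List PT → List PT → Set

data _⇝_ where
  βλ   : ∀ {u t} → (ƛ u) · t ⇝ u [ t ]P
  βΛ   : ∀ {u m} → (Λ u) ·ₙ m ⇝ substNP (single m) u
  βπ₀  : ∀ {u₀ u₁} → π₀ ⟨ u₀ , u₁ ⟩ ⇝ u₀
  βπ₁  : ∀ {u₀ u₁} → π₁ ⟨ u₀ , u₁ ⟩ ⇝ u₁
  βinj₀ : ∀ {u t₀ t₁} → case (inj₀ u) t₀ t₁ ⇝ t₀ [ u ]P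
  βinj₁ : ∀ {u t₀ t₁} → case (inj₁ u) t₀ t₁ ⇝ t₁ [ u ]P
  β∃   : ∀ {n u v} → IsNum n → exE ⟪ n , u ⟫ v ⇝ (substNP (single n) v) [ u ]P
  βR0  : ∀ {u v} → Rec u v 𝟎 ⇝ u
  βRS  : ∀ {u v n} → IsNum n → Rec u v (𝐒 n) ⇝ (v ·ₙ n) · Rec u v n
  E·   : ∀ {u v w} → Em u v · w ⇝ Em (u · w) (v · w)
  E·ₙ  : ∀ {u v m} → Em u v ·ₙ m ⇝ Em (u ·ₙ m) (v ·ₙ m)
  Eπ₀  : ∀ {u v} → π₀ (Em u v) ⇝ Em (π₀ u) (π₀ v)
  Eπ₁  : ∀ {u v} → π₁ (Em u v) ⇝ Em (π₁ u) (π₁ v)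
  Ecase : ∀ {u v w₁ w₂} → case (Em u v) w₁ w₂ ⇝ Em (case u w₁ w₂) (case v w₁ w₂)
  EexE : ∀ {u v w} → exE (Em u v) w ⇝ Em (exE u w) (exE v w)
  βH   : ∀ {P n} → TrueA (substA (single n) P) → Hyp P ·ₙ n ⇝ TT
  βW   : ∀ {P n} → IsNum n → Wit P ⇝ ⟪ n , TT ⟫
  E₀   : ∀ {u v} → Em u v ⇝ u
  E₁   : ∀ {u v} → Em u v ⇝ v
  ·ˡ   : ∀ {t t' u} → t ⇝ t' → t · u ⇝ t' · u
  ·ʳ   : ∀ {t u u'} → u ⇝ u' → t · u ⇝ t · u'
  ·ₙˡ  : ∀ {t t' m} → t ⇝ t' → t ·ₙ m ⇝ t' ·ₙ m
  ƛc   : ∀ {u u'} → u ⇝ u' → ƛ u ⇝ ƛ u'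
  Λc   : ∀ {u u'} → u ⇝ u' → Λ u ⇝ Λ u'
  ⟨⟩ˡ  : ∀ {t t' u} → t ⇝ t' → ⟨ t , u ⟩ ⇝ ⟨ t' , u ⟩
  ⟨⟩ʳ  : ∀ {t u u'} → u ⇝ u' → ⟨ t , u ⟩ ⇝ ⟨ t , u' ⟩
  π₀c  : ∀ {t t'} → t ⇝ t' → π₀ t ⇝ π₀ t'
  π₁c  : ∀ {t t'} → t ⇝ t' → π₁ t ⇝ π₁ t'
  inj₀c : ∀ {t t'} → t ⇝ t' → inj₀ t ⇝ inj₀ t'
  inj₁c : ∀ {t t'} → t ⇝ t' → inj₁ t ⇝ inj₁ t'
  case₁ : ∀ {t t' u v} → t ⇝ t' → case t u v ⇝ case t' u v
  case₂ : ∀ {t u u' v} → u ⇝ u' → case t u v ⇝ case t u' v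
  case₃ : ∀ {t u v v'} → v ⇝ v' → case t u v ⇝ case t u v'
  ⟪⟫c  : ∀ {m t t'} → t ⇝ t' → ⟪ m , t ⟫ ⇝ ⟪ m , t' ⟫
  exE₁ : ∀ {t t' u} → t ⇝ t' → exE t u ⇝ exE t' u
  exE₂ : ∀ {t u u'} → u ⇝ u' → exE t u ⇝ exE t u'
  Emˡ  : ∀ {t t' u} → t ⇝ t' → Em t u ⇝ Em t' u
  Emʳ  : ∀ {t u u'} → u ⇝ u' → Em t u ⇝ Em t u'
  Rec₁ : ∀ {t t' u m} → t ⇝ t' → Rec t u m ⇝ Rec t' u m
  Rec₂ : ∀ {t u u' m} → u ⇝ u' → Rec t u m ⇝ Rec t u' m
  rcc  : ∀ {ts ts'} → ts ⇝ₗ ts' → rc ts ⇝ rc ts'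

data _⇝ₗ_ where
  hd : ∀ {t t' ts} → t ⇝ t' → (t ∷ ts) ⇝ₗ (t' ∷ ts)
  tl : ∀ {t ts ts'} → ts ⇝ₗ ts' → (t ∷ ts) ⇝ₗ (t ∷ ts')

_⇝*_ : PT → PT → Set
_⇝*_ = Star _⇝_

data SN (t : PT) : Set where
  sn : (∀ {t'} → t ⇝ t' → SN t') → SN t

-- Reducibility.  Red A σ t means  t ⊩ A[σ]  (σ a numeric substitution);
-- the ∀/∃ clauses use (A[σ↑])[n/α] = A[n ∷ σ].

_∷ₛ_ : Tm → Sub → Sub
(n ∷ₛ σ) zero = n
(n ∷ₛ σ) (suc i) = σ i

Red : Fm → Sub → PT → Set
Red (atm P) σ t = SN t
Red (A ∧' B) σ t = Red A σ (π₀ t) × Red B σ (π₁ t)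
Red (A ⇒ B) σ t = ∀ u → Red A σ u → Red B σ (t · u)
Red (A ∨' B) σ t = SN t × (∀ u → t ⇝* inj₀ u → Red A σ u)
                        × (∀ u → t ⇝* inj₁ u → Red B σ u)
Red (∀' A) σ t = ∀ (n : Tm) → Red A (n ∷ₛ σ) (t ·ₙ n)
Red (∃' A) σ t = SN t × (∀ (n : Tm) u → t ⇝* ⟪ n , u ⟫ → Red A (n ∷ₛ σ) u)

infix 4 _⊩_
_⊩_ : PT → Fm → Set
t ⊩ A = Red A vr t

data Entry : Set where
  pf : Fm → Entry      -- x : A   (proof-term variable)
  hy : Fm → Entry      -- a : A   (hypothesis variable)

Ctx : Set
Ctx = List Entry       -- head = rightmost declaration

shiftE : Entry → Entry
shiftE (pf A) = pf (shiftF A)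
shiftE (hy A) = hy (shiftF A)

shiftCtx : Ctx → Ctx
shiftCtx = map shiftE

data _∋_⦂_ : Ctx → ℕ → Fm → Set where
  here   : ∀ {Γ A} → (pf A ∷ Γ) ∋ zero ⦂ A
  thereP : ∀ {Γ i A B} → Γ ∋ i ⦂ A → (pf B ∷ Γ) ∋ suc i ⦂ A
  thereH : ∀ {Γ i A B} → Γ ∋ i ⦂ A → (hy B ∷ Γ) ∋ i ⦂ A

postT : List PT → PT
postT [] = TT
postT (u ∷ us) = rc (u ∷ us)

infix 3 _⊢_⦂_
data _⊢_⦂_ (Γ : Ctx) : PT → Fm → Set where
  ax    : ∀ {i A} → Γ ∋ i ⦂ A → Γ ⊢ pv i ⦂ A
  axH   : ∀ {P} → hy (∀' (atm P)) ∈ Γ → Γ ⊢ Hyp P ⦂ ∀' (atm P)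
  axW   : ∀ {P} → hy (∃' (atm (negA P))) ∈ Γ → Γ ⊢ Wit P ⦂ ∃' (atm (negA P))
  ∧I    : ∀ {u t A B} → Γ ⊢ u ⦂ A → Γ ⊢ t ⦂ B → Γ ⊢ ⟨ u , t ⟩ ⦂ A ∧' B
  ∧E₀   : ∀ {u A B} → Γ ⊢ u ⦂ A ∧' B → Γ ⊢ π₀ u ⦂ A
  ∧E₁   : ∀ {u A B} → Γ ⊢ u ⦂ A ∧' B → Γ ⊢ π₁ u ⦂ B
  ⇒E    : ∀ {t u A B} → Γ ⊢ t ⦂ A ⇒ B → Γ ⊢ u ⦂ A → Γ ⊢ t · u ⦂ B
  ⇒I    : ∀ {u A B} → (pf A ∷ Γ) ⊢ u ⦂ B → Γ ⊢ ƛ u ⦂ A ⇒ B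
  ∨I₀   : ∀ {u A B} → Γ ⊢ u ⦂ A → Γ ⊢ inj₀ u ⦂ A ∨' B
  ∨I₁   : ∀ {u A B} → Γ ⊢ u ⦂ B → Γ ⊢ inj₁ u ⦂ A ∨' B
  ∨E    : ∀ {u w₁ w₂ A B C} → Γ ⊢ u ⦂ A ∨' B → (pf A ∷ Γ) ⊢ w₁ ⦂ C
          → (pf B ∷ Γ) ⊢ w₂ ⦂ C → Γ ⊢ case u w₁ w₂ ⦂ C
  ∀E    : ∀ {u A} (m : Tm) → Γ ⊢ u ⦂ ∀' A → Γ ⊢ u ·ₙ m ⦂ A [ m ]F
  ∀I    : ∀ {u A} → shiftCtx Γ ⊢ u ⦂ A → Γ ⊢ Λ u ⦂ ∀' A
  ∃I    : ∀ {u A} (m : Tm) → Γ ⊢ u ⦂ A [ m ]F → Γ ⊢ ⟪ m , u ⟫ ⦂ ∃' A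
  ∃E    : ∀ {u t A C} → Γ ⊢ u ⦂ ∃' A → (pf A ∷ shiftCtx Γ) ⊢ t ⦂ shiftF C
          → Γ ⊢ exE u t ⦂ C
  ind   : ∀ {u v A} (m : Tm) → Γ ⊢ u ⦂ A [ 𝟎 ]F
          → Γ ⊢ v ⦂ ∀' (A ⇒ substF stepS A) → Γ ⊢ Rec u v m ⦂ A [ m ]F
  post  : ∀ {us Ps P} → Pointwise (λ u Q → Γ ⊢ u ⦂ atm Q) us Ps
          → PostValid Ps P → Γ ⊢ postT us ⦂ atm P
  nem   : ∀ {w₁ w₂ P C} → (hy (∀' (atm P)) ∷ Γ) ⊢ w₁ ⦂ C
          → (hy (∃' (atm (negA P))) ∷ Γ) ⊢ w₂ ⦂ C → Γ ⊢ Em w₁ w₂ ⦂ C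

-- Free numeric variables among the first k (α₁ … αₖ ↔ indices 0 … k-1)

BoundT : ℕ → Tm → Set
BoundT k (vr i) = i < k
BoundT k 𝟎 = ⊤
BoundT k (𝐒 t) = BoundT k t

BoundTs : ∀ {n} → ℕ → Vec Tm n → Set
BoundTs k [] = ⊤
BoundTs k (t ∷ ts) = BoundT k t × BoundTs k ts

BoundF : ℕ → Fm → Set
BoundF k (atm (s ⦅ ts ⦆)) = BoundTs k ts
BoundF k (A ∧' B) = BoundF k A × BoundF k B
BoundF k (A ∨' B) = BoundF k A × BoundF k B
BoundF k (A ⇒ B) = BoundF k A × BoundF k B
BoundF k (∀' A) = BoundF (suc k) A
BoundF k (∃' A) = BoundF (suc k) A

-- Γ = x₁:A₁,…,xₙ:Aₙ,Δ ; the proof variable with de Bruijn index i is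
-- declared with formula (lookup As i) (index 0 = rightmost, xₙ)
ctxOf : ∀ {n} → Vec Fm n → List Fm → Ctx
ctxOf As Δ = map hy Δ ++ map pf (toList As)

numSub : ∀ {k} → Vec Tm k → Sub
numSub {k} rs i with i <? k
... | yes p = lookup rs (fromℕ< p)
... | no _ = vr i

pfSub : ∀ {n} → Vec PT n → PSub
pfSub {n} ts i with i <? n
... | yes p = lookup ts (fromℕ< p)
... | no _ = pv i

-- Tait–Girard reducibility.  The clauses of t ⊩ A never inspect the terms of
-- L occurring in A, so t ⊩ A[σ] depends only on the propositional skeleton of
-- A, a simple type.  Reducibility over skeletons satisfies CR1–CR3; it is
-- closed under E(u, v), because E commutes with every eliminator and otherwise
-- only steps to u or v; and H, W are reducible outright, as they reduce only to
-- True and (n, True).  Adequacy then follows by induction on derivations,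
-- simultaneously for every numeric substitution σ and every reducible proof
-- substitution τ.  Reducibility of τ does not mention σ.

module Submission where

open import Defs
open import Data.Empty using (⊥; ⊥-elim)
open import Data.Fin using (Fin; fromℕ<)
open import Data.List using (List; []; _∷_; map; _++_)
open import Data.List.Relation.Binary.Pointwise using (Pointwise; []; _∷_)
open import Data.List.Relation.Unary.All using (All; []; _∷_)
open import Data.Maybe using (just; nothing)
open import Data.Nat using (ℕ; zero; suc; _<_; _<?_; s≤s; z≤n)
open import Data.Product using (Σ-syntax; ∃-syntax; _×_; _,_; proj₁; proj₂)
open import Data.Sum using (_⊎_; inj₁; inj₂; [_,_]; map₁; map₂)
open import Data.Vec using (Vec; []; _∷_; lookup; toList)
import Data.Vec as Vec
import Data.Vec.Properties as Vecₚ
open import Function using (_∘_; case_of_)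
open import Function.Nary.NonDependent using (congₙ)
open import Relation.Binary.Construct.Closure.ReflexiveTransitive using (ε; _◅_)
open import Relation.Binary.PropositionalEquality hiding ([_])
open import Relation.Nullary using (yes; no; contradiction)

-- Composition laws are stated against any τ pointwise equal to the composite,
-- so no separate congruence lemmas are needed.

shiftT-liftS : ∀ σ t → substT (liftS σ) (shiftT t) ≡ shiftT (substT σ t)
shiftT-liftS σ (vr i) = refl
shiftT-liftS σ 𝟎 = refl
shiftT-liftS σ (𝐒 t) = cong 𝐒 (shiftT-liftS σ t)

substT-∘ : ∀ {σ ρ τ} → substT σ ∘ ρ ≗ τ → ∀ t → substT σ (substT ρ t) ≡ substT τ t
substT-∘ e (vr i) = e i
substT-∘ e 𝟎 = refl
substT-∘ e (𝐒 t) = cong 𝐒 (substT-∘ e t)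

substT-id : ∀ {σ} → σ ≗ vr → ∀ t → substT σ t ≡ t
substT-id e (vr i) = e i
substT-id e 𝟎 = refl
substT-id e (𝐒 t) = cong 𝐒 (substT-id e t)

liftS-∘ : ∀ {σ ρ τ} → substT σ ∘ ρ ≗ τ → substT (liftS σ) ∘ liftS ρ ≗ liftS τ
liftS-∘ e zero = refl
liftS-∘ {σ} {ρ} e (suc i) = trans (shiftT-liftS σ (ρ i)) (cong shiftT (e i))

liftS-id : ∀ {σ} → σ ≗ vr → liftS σ ≗ vr
liftS-id e zero = refl
liftS-id e (suc i) = cong shiftT (e i)

substA-∘ : ∀ {σ ρ τ} → substT σ ∘ ρ ≗ τ → ∀ P → substA σ (substA ρ P) ≡ substA τ P
substA-∘ e (s ⦅ ts ⦆) =
  cong (s ⦅_⦆) (trans (sym (Vecₚ.map-∘ _ _ ts)) (Vecₚ.map-cong (substT-∘ e) ts))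

substA-id : ∀ {σ} → σ ≗ vr → ∀ P → substA σ P ≡ P
substA-id e (s ⦅ ts ⦆) = cong (s ⦅_⦆) (trans (Vecₚ.map-cong (substT-id e) ts) (Vecₚ.map-id ts))

mutual
  substNP-∘ : ∀ {σ ρ τ} → substT σ ∘ ρ ≗ τ →
              ∀ t → substNP σ (substNP ρ t) ≡ substNP τ t
  substNP-∘ e (pv x) = refl
  substNP-∘ e (t · u) = cong₂ _·_ (substNP-∘ e t) (substNP-∘ e u)
  substNP-∘ e (t ·ₙ m) = cong₂ _·ₙ_ (substNP-∘ e t) (substT-∘ e m)
  substNP-∘ e (ƛ u) = cong ƛ_ (substNP-∘ e u)
  substNP-∘ e (Λ u) = cong Λ_ (substNP-∘ (liftS-∘ e) u)
  substNP-∘ e ⟨ t , u ⟩ = cong₂ ⟨_,_⟩ (substNP-∘ e t) (substNP-∘ e u)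
  substNP-∘ e (π₀ t) = cong π₀ (substNP-∘ e t)
  substNP-∘ e (π₁ t) = cong π₁ (substNP-∘ e t)
  substNP-∘ e (inj₀ t) = cong inj₀ (substNP-∘ e t)
  substNP-∘ e (inj₁ t) = cong inj₁ (substNP-∘ e t)
  substNP-∘ e (case t u v) = congₙ 3 case (substNP-∘ e t) (substNP-∘ e u) (substNP-∘ e v)
  substNP-∘ e ⟪ m , t ⟫ = cong₂ ⟪_,_⟫ (substT-∘ e m) (substNP-∘ e t)
  substNP-∘ e (exE t u) = cong₂ exE (substNP-∘ e t) (substNP-∘ (liftS-∘ e) u)
  substNP-∘ e (Em t u) = cong₂ Em (substNP-∘ e t) (substNP-∘ e u)
  substNP-∘ e (Hyp P) = cong Hyp (substA-∘ (liftS-∘ e) P)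
  substNP-∘ e (Wit P) = cong Wit (substA-∘ (liftS-∘ e) P)
  substNP-∘ e TT = refl
  substNP-∘ e (Rec t u m) = congₙ 3 Rec (substNP-∘ e t) (substNP-∘ e u) (substT-∘ e m)
  substNP-∘ e (rc ts) = cong rc (substNPs-∘ e ts)

  substNPs-∘ : ∀ {σ ρ τ} → substT σ ∘ ρ ≗ τ →
               ∀ ts → substNPs σ (substNPs ρ ts) ≡ substNPs τ ts
  substNPs-∘ e [] = refl
  substNPs-∘ e (t ∷ ts) = cong₂ _∷_ (substNP-∘ e t) (substNPs-∘ e ts)

mutual
  substNP-id : ∀ {σ} → σ ≗ vr → ∀ t → substNP σ t ≡ t
  substNP-id e (pv x) = refl
  substNP-id e (t · u) = cong₂ _·_ (substNP-id e t) (substNP-id e u)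
  substNP-id e (t ·ₙ m) = cong₂ _·ₙ_ (substNP-id e t) (substT-id e m)
  substNP-id e (ƛ u) = cong ƛ_ (substNP-id e u)
  substNP-id e (Λ u) = cong Λ_ (substNP-id (liftS-id e) u)
  substNP-id e ⟨ t , u ⟩ = cong₂ ⟨_,_⟩ (substNP-id e t) (substNP-id e u)
  substNP-id e (π₀ t) = cong π₀ (substNP-id e t)
  substNP-id e (π₁ t) = cong π₁ (substNP-id e t)
  substNP-id e (inj₀ t) = cong inj₀ (substNP-id e t)
  substNP-id e (inj₁ t) = cong inj₁ (substNP-id e t)
  substNP-id e (case t u v) = congₙ 3 case (substNP-id e t) (substNP-id e u) (substNP-id e v)
  substNP-id e ⟪ m , t ⟫ = cong₂ ⟪_,_⟫ (substT-id e m) (substNP-id e t)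
  substNP-id e (exE t u) = cong₂ exE (substNP-id e t) (substNP-id (liftS-id e) u)
  substNP-id e (Em t u) = cong₂ Em (substNP-id e t) (substNP-id e u)
  substNP-id e (Hyp P) = cong Hyp (substA-id (liftS-id e) P)
  substNP-id e (Wit P) = cong Wit (substA-id (liftS-id e) P)
  substNP-id e TT = refl
  substNP-id e (Rec t u m) = congₙ 3 Rec (substNP-id e t) (substNP-id e u) (substT-id e m)
  substNP-id e (rc ts) = cong rc (substNPs-id e ts)

  substNPs-id : ∀ {σ} → σ ≗ vr → ∀ ts → substNPs σ ts ≡ ts
  substNPs-id e [] = refl
  substNPs-id e (t ∷ ts) = cong₂ _∷_ (substNP-id e t) (substNPs-id e ts)

single-shiftNP : ∀ m t → substNP (single m) (shiftNP t) ≡ t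
single-shiftNP m t = trans (substNP-∘ (λ _ → refl) t) (substNP-id (λ _ → refl) t)

shiftNP-liftS : ∀ σ t → substNP (liftS σ) (shiftNP t) ≡ shiftNP (substNP σ t)
shiftNP-liftS σ t = trans (substNP-∘ (λ _ → refl) t) (sym (substNP-∘ (λ _ → refl) t))

liftR-∘ : ∀ {g f h} → g ∘ f ≗ h → liftR g ∘ liftR f ≗ liftR h
liftR-∘ e zero = refl
liftR-∘ e (suc i) = cong suc (e i)

mutual
  renP-∘ : ∀ {g f h} → g ∘ f ≗ h → ∀ t → renP g (renP f t) ≡ renP h t
  renP-∘ e (pv x) = cong pv (e x)
  renP-∘ e (t · u) = cong₂ _·_ (renP-∘ e t) (renP-∘ e u)
  renP-∘ e (t ·ₙ m) = cong (_·ₙ m) (renP-∘ e t)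
  renP-∘ e (ƛ u) = cong ƛ_ (renP-∘ (liftR-∘ e) u)
  renP-∘ e (Λ u) = cong Λ_ (renP-∘ e u)
  renP-∘ e ⟨ t , u ⟩ = cong₂ ⟨_,_⟩ (renP-∘ e t) (renP-∘ e u)
  renP-∘ e (π₀ t) = cong π₀ (renP-∘ e t)
  renP-∘ e (π₁ t) = cong π₁ (renP-∘ e t)
  renP-∘ e (inj₀ t) = cong inj₀ (renP-∘ e t)
  renP-∘ e (inj₁ t) = cong inj₁ (renP-∘ e t)
  renP-∘ e (case t u v) =
    congₙ 3 case (renP-∘ e t) (renP-∘ (liftR-∘ e) u) (renP-∘ (liftR-∘ e) v)
  renP-∘ e ⟪ m , t ⟫ = cong ⟪ m ,_⟫ (renP-∘ e t)
  renP-∘ e (exE t u) = cong₂ exE (renP-∘ e t) (renP-∘ (liftR-∘ e) u)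
  renP-∘ e (Em t u) = cong₂ Em (renP-∘ e t) (renP-∘ e u)
  renP-∘ e (Hyp P) = refl
  renP-∘ e (Wit P) = refl
  renP-∘ e TT = refl
  renP-∘ e (Rec t u m) = cong₂ (λ a b → Rec a b m) (renP-∘ e t) (renP-∘ e u)
  renP-∘ e (rc ts) = cong rc (renPs-∘ e ts)

  renPs-∘ : ∀ {g f h} → g ∘ f ≗ h → ∀ ts → renPs g (renPs f ts) ≡ renPs h ts
  renPs-∘ e [] = refl
  renPs-∘ e (t ∷ ts) = cong₂ _∷_ (renP-∘ e t) (renPs-∘ e ts)

mutual
  substNP-renP : ∀ σ f t → substNP σ (renP f t) ≡ renP f (substNP σ t)
  substNP-renP σ f (pv x) = refl
  substNP-renP σ f (t · u) = cong₂ _·_ (substNP-renP σ f t) (substNP-renP σ f u)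
  substNP-renP σ f (t ·ₙ m) = cong (_·ₙ substT σ m) (substNP-renP σ f t)
  substNP-renP σ f (ƛ u) = cong ƛ_ (substNP-renP σ (liftR f) u)
  substNP-renP σ f (Λ u) = cong Λ_ (substNP-renP (liftS σ) f u)
  substNP-renP σ f ⟨ t , u ⟩ = cong₂ ⟨_,_⟩ (substNP-renP σ f t) (substNP-renP σ f u)
  substNP-renP σ f (π₀ t) = cong π₀ (substNP-renP σ f t)
  substNP-renP σ f (π₁ t) = cong π₁ (substNP-renP σ f t)
  substNP-renP σ f (inj₀ t) = cong inj₀ (substNP-renP σ f t)
  substNP-renP σ f (inj₁ t) = cong inj₁ (substNP-renP σ f t)
  substNP-renP σ f (case t u v) =
    congₙ 3 case (substNP-renP σ f t) (substNP-renP σ (liftR f) u) (substNP-renP σ (liftR f) v)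
  substNP-renP σ f ⟪ m , t ⟫ = cong ⟪ substT σ m ,_⟫ (substNP-renP σ f t)
  substNP-renP σ f (exE t u) = cong₂ exE (substNP-renP σ f t) (substNP-renP (liftS σ) (liftR f) u)
  substNP-renP σ f (Em t u) = cong₂ Em (substNP-renP σ f t) (substNP-renP σ f u)
  substNP-renP σ f (Hyp P) = refl
  substNP-renP σ f (Wit P) = refl
  substNP-renP σ f TT = refl
  substNP-renP σ f (Rec t u m) =
    cong₂ (λ a b → Rec a b (substT σ m)) (substNP-renP σ f t) (substNP-renP σ f u)
  substNP-renP σ f (rc ts) = cong rc (substNPs-renPs σ f ts)

  substNPs-renPs : ∀ σ f ts → substNPs σ (renPs f ts) ≡ renPs f (substNPs σ ts)
  substNPs-renPs σ f [] = refl
  substNPs-renPs σ f (t ∷ ts) = cong₂ _∷_ (substNP-renP σ f t) (substNPs-renPs σ f ts)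

liftP-renP : ∀ {ρ f τ} → ρ ∘ f ≗ τ → liftP ρ ∘ liftR f ≗ liftP τ
liftP-renP e zero = refl
liftP-renP e (suc i) = cong (renP suc) (e i)

liftNP-cong : ∀ {ρ τ} → ρ ≗ τ → liftNP ρ ≗ liftNP τ
liftNP-cong e i = cong shiftNP (e i)

mutual
  substP-renP : ∀ {ρ f τ} → ρ ∘ f ≗ τ → ∀ t → substP ρ (renP f t) ≡ substP τ t
  substP-renP e (pv x) = e x
  substP-renP e (t · u) = cong₂ _·_ (substP-renP e t) (substP-renP e u)
  substP-renP e (t ·ₙ m) = cong (_·ₙ m) (substP-renP e t)
  substP-renP e (ƛ u) = cong ƛ_ (substP-renP (liftP-renP e) u)
  substP-renP e (Λ u) = cong Λ_ (substP-renP (liftNP-cong e) u)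
  substP-renP e ⟨ t , u ⟩ = cong₂ ⟨_,_⟩ (substP-renP e t) (substP-renP e u)
  substP-renP e (π₀ t) = cong π₀ (substP-renP e t)
  substP-renP e (π₁ t) = cong π₁ (substP-renP e t)
  substP-renP e (inj₀ t) = cong inj₀ (substP-renP e t)
  substP-renP e (inj₁ t) = cong inj₁ (substP-renP e t)
  substP-renP e (case t u v) =
    congₙ 3 case (substP-renP e t) (substP-renP (liftP-renP e) u) (substP-renP (liftP-renP e) v)
  substP-renP e ⟪ m , t ⟫ = cong ⟪ m ,_⟫ (substP-renP e t)
  substP-renP e (exE t u) = cong₂ exE (substP-renP e t) (substP-renP (liftP-renP (liftNP-cong e)) u)
  substP-renP e (Em t u) = cong₂ Em (substP-renP e t) (substP-renP e u)
  substP-renP e (Hyp P) = refl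
  substP-renP e (Wit P) = refl
  substP-renP e TT = refl
  substP-renP e (Rec t u m) = cong₂ (λ a b → Rec a b m) (substP-renP e t) (substP-renP e u)
  substP-renP e (rc ts) = cong rc (substPs-renPs e ts)

  substPs-renPs : ∀ {ρ f τ} → ρ ∘ f ≗ τ → ∀ ts → substPs ρ (renPs f ts) ≡ substPs τ ts
  substPs-renPs e [] = refl
  substPs-renPs e (t ∷ ts) = cong₂ _∷_ (substP-renP e t) (substPs-renPs e ts)

renP-liftP : ∀ {f ρ τ} → renP f ∘ ρ ≗ τ → renP (liftR f) ∘ liftP ρ ≗ liftP τ
renP-liftP e zero = refl
renP-liftP {f} {ρ} e (suc i) =
  trans (renP-∘ (λ _ → refl) (ρ i))
        (trans (sym (renP-∘ (λ _ → refl) (ρ i))) (cong (renP suc) (e i)))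

renP-liftNP : ∀ {f ρ τ} → renP f ∘ ρ ≗ τ → renP f ∘ liftNP ρ ≗ liftNP τ
renP-liftNP {f} {ρ} e i = trans (sym (substNP-renP _ f (ρ i))) (cong shiftNP (e i))

mutual
  renP-substP : ∀ {f ρ τ} → renP f ∘ ρ ≗ τ → ∀ t → renP f (substP ρ t) ≡ substP τ t
  renP-substP e (pv x) = e x
  renP-substP e (t · u) = cong₂ _·_ (renP-substP e t) (renP-substP e u)
  renP-substP e (t ·ₙ m) = cong (_·ₙ m) (renP-substP e t)
  renP-substP e (ƛ u) = cong ƛ_ (renP-substP (renP-liftP e) u)
  renP-substP e (Λ u) = cong Λ_ (renP-substP (renP-liftNP e) u)
  renP-substP e ⟨ t , u ⟩ = cong₂ ⟨_,_⟩ (renP-substP e t) (renP-substP e u)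
  renP-substP e (π₀ t) = cong π₀ (renP-substP e t)
  renP-substP e (π₁ t) = cong π₁ (renP-substP e t)
  renP-substP e (inj₀ t) = cong inj₀ (renP-substP e t)
  renP-substP e (inj₁ t) = cong inj₁ (renP-substP e t)
  renP-substP e (case t u v) =
    congₙ 3 case (renP-substP e t) (renP-substP (renP-liftP e) u) (renP-substP (renP-liftP e) v)
  renP-substP e ⟪ m , t ⟫ = cong ⟪ m ,_⟫ (renP-substP e t)
  renP-substP e (exE t u) = cong₂ exE (renP-substP e t) (renP-substP (renP-liftP (renP-liftNP e)) u)
  renP-substP e (Em t u) = cong₂ Em (renP-substP e t) (renP-substP e u)
  renP-substP e (Hyp P) = refl
  renP-substP e (Wit P) = refl
  renP-substP e TT = refl
  renP-substP e (Rec t u m) = cong₂ (λ a b → Rec a b m) (renP-substP e t) (renP-substP e u)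
  renP-substP e (rc ts) = cong rc (renPs-substPs e ts)

  renPs-substPs : ∀ {f ρ τ} → renP f ∘ ρ ≗ τ →
                  ∀ ts → renPs f (substPs ρ ts) ≡ substPs τ ts
  renPs-substPs e [] = refl
  renPs-substPs e (t ∷ ts) = cong₂ _∷_ (renP-substP e t) (renPs-substPs e ts)

substNP-liftP : ∀ {σ ρ τ} → substNP σ ∘ ρ ≗ τ → substNP σ ∘ liftP ρ ≗ liftP τ
substNP-liftP e zero = refl
substNP-liftP {σ} {ρ} e (suc i) = trans (substNP-renP σ suc (ρ i)) (cong (renP suc) (e i))

substNP-liftNP : ∀ {σ ρ τ} → substNP σ ∘ ρ ≗ τ →
                 substNP (liftS σ) ∘ liftNP ρ ≗ liftNP τ
substNP-liftNP {σ} {ρ} e i = trans (shiftNP-liftS σ (ρ i)) (cong shiftNP (e i))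

mutual
  substNP-substP : ∀ {σ ρ τ} → substNP σ ∘ ρ ≗ τ → ∀ t
    → substNP σ (substP ρ t) ≡ substP τ (substNP σ t)
  substNP-substP e (pv x) = e x
  substNP-substP e (t · u) = cong₂ _·_ (substNP-substP e t) (substNP-substP e u)
  substNP-substP {σ} e (t ·ₙ m) = cong (_·ₙ substT σ m) (substNP-substP e t)
  substNP-substP e (ƛ u) = cong ƛ_ (substNP-substP (substNP-liftP e) u)
  substNP-substP e (Λ u) = cong Λ_ (substNP-substP (substNP-liftNP e) u)
  substNP-substP e ⟨ t , u ⟩ = cong₂ ⟨_,_⟩ (substNP-substP e t) (substNP-substP e u)
  substNP-substP e (π₀ t) = cong π₀ (substNP-substP e t)
  substNP-substP e (π₁ t) = cong π₁ (substNP-substP e t)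
  substNP-substP e (inj₀ t) = cong inj₀ (substNP-substP e t)
  substNP-substP e (inj₁ t) = cong inj₁ (substNP-substP e t)
  substNP-substP e (case t u v) = congₙ 3 case (substNP-substP e t)
    (substNP-substP (substNP-liftP e) u) (substNP-substP (substNP-liftP e) v)
  substNP-substP {σ} e ⟪ m , t ⟫ = cong ⟪ substT σ m ,_⟫ (substNP-substP e t)
  substNP-substP e (exE t u) =
    cong₂ exE (substNP-substP e t) (substNP-substP (substNP-liftP (substNP-liftNP e)) u)
  substNP-substP e (Em t u) = cong₂ Em (substNP-substP e t) (substNP-substP e u)
  substNP-substP e (Hyp P) = refl
  substNP-substP e (Wit P) = refl
  substNP-substP e TT = refl
  substNP-substP {σ} e (Rec t u m) =
    cong₂ (λ a b → Rec a b (substT σ m)) (substNP-substP e t) (substNP-substP e u)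
  substNP-substP e (rc ts) = cong rc (substNPs-substPs e ts)

  substNPs-substPs : ∀ {σ ρ τ} → substNP σ ∘ ρ ≗ τ → ∀ ts
    → substNPs σ (substPs ρ ts) ≡ substPs τ (substNPs σ ts)
  substNPs-substPs e [] = refl
  substNPs-substPs e (t ∷ ts) = cong₂ _∷_ (substNP-substP e t) (substNPs-substPs e ts)

substP-liftP : ∀ {ρ τ υ} → substP ρ ∘ τ ≗ υ → substP (liftP ρ) ∘ liftP τ ≗ liftP υ
substP-liftP e zero = refl
substP-liftP {ρ} {τ} {υ} e (suc i) = begin
  substP (liftP ρ) (renP suc (τ i))  ≡⟨ substP-renP (λ _ → refl) (τ i) ⟩
  substP (renP suc ∘ ρ) (τ i)        ≡⟨ renP-substP (λ _ → refl) (τ i) ⟨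
  renP suc (substP ρ (τ i))          ≡⟨ cong (renP suc) (e i) ⟩
  renP suc (υ i)                     ∎
  where open ≡-Reasoning

substP-liftNP : ∀ ρ τ {υ} → substP ρ ∘ τ ≗ υ → substP (liftNP ρ) ∘ liftNP τ ≗ liftNP υ
substP-liftNP ρ τ e i =
  trans (sym (substNP-substP {ρ = ρ} (λ _ → refl) (τ i))) (cong shiftNP (e i))

mutual
  substP-∘ : ∀ {ρ τ υ} → substP ρ ∘ τ ≗ υ →
             ∀ t → substP ρ (substP τ t) ≡ substP υ t
  substP-∘ e (pv x) = e x
  substP-∘ e (t · u) = cong₂ _·_ (substP-∘ e t) (substP-∘ e u)
  substP-∘ e (t ·ₙ m) = cong (_·ₙ m) (substP-∘ e t)
  substP-∘ e (ƛ u) = cong ƛ_ (substP-∘ (substP-liftP e) u)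
  substP-∘ {ρ} {τ} e (Λ u) = cong Λ_ (substP-∘ (substP-liftNP ρ τ e) u)
  substP-∘ e ⟨ t , u ⟩ = cong₂ ⟨_,_⟩ (substP-∘ e t) (substP-∘ e u)
  substP-∘ e (π₀ t) = cong π₀ (substP-∘ e t)
  substP-∘ e (π₁ t) = cong π₁ (substP-∘ e t)
  substP-∘ e (inj₀ t) = cong inj₀ (substP-∘ e t)
  substP-∘ e (inj₁ t) = cong inj₁ (substP-∘ e t)
  substP-∘ e (case t u v) =
    congₙ 3 case (substP-∘ e t) (substP-∘ (substP-liftP e) u) (substP-∘ (substP-liftP e) v)
  substP-∘ e ⟪ m , t ⟫ = cong ⟪ m ,_⟫ (substP-∘ e t)
  substP-∘ {ρ} {τ} e (exE t u) =
    cong₂ exE (substP-∘ e t) (substP-∘ (substP-liftP (substP-liftNP ρ τ e)) u)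
  substP-∘ e (Em t u) = cong₂ Em (substP-∘ e t) (substP-∘ e u)
  substP-∘ e (Hyp P) = refl
  substP-∘ e (Wit P) = refl
  substP-∘ e TT = refl
  substP-∘ e (Rec t u m) = cong₂ (λ a b → Rec a b m) (substP-∘ e t) (substP-∘ e u)
  substP-∘ e (rc ts) = cong rc (substPs-∘ e ts)

  substPs-∘ : ∀ {ρ τ υ} → substP ρ ∘ τ ≗ υ →
              ∀ ts → substPs ρ (substPs τ ts) ≡ substPs υ ts
  substPs-∘ e [] = refl
  substPs-∘ e (t ∷ ts) = cong₂ _∷_ (substP-∘ e t) (substPs-∘ e ts)

liftP-id : ∀ {ρ} → ρ ≗ pv → liftP ρ ≗ pv
liftP-id e zero = refl
liftP-id e (suc i) = cong (renP suc) (e i)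

mutual
  substP-id : ∀ {ρ} → ρ ≗ pv → ∀ t → substP ρ t ≡ t
  substP-id e (pv x) = e x
  substP-id e (t · u) = cong₂ _·_ (substP-id e t) (substP-id e u)
  substP-id e (t ·ₙ m) = cong (_·ₙ m) (substP-id e t)
  substP-id e (ƛ u) = cong ƛ_ (substP-id (liftP-id e) u)
  substP-id e (Λ u) = cong Λ_ (substP-id (liftNP-cong e) u)
  substP-id e ⟨ t , u ⟩ = cong₂ ⟨_,_⟩ (substP-id e t) (substP-id e u)
  substP-id e (π₀ t) = cong π₀ (substP-id e t)
  substP-id e (π₁ t) = cong π₁ (substP-id e t)
  substP-id e (inj₀ t) = cong inj₀ (substP-id e t)
  substP-id e (inj₁ t) = cong inj₁ (substP-id e t)
  substP-id e (case t u v) =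
    congₙ 3 case (substP-id e t) (substP-id (liftP-id e) u) (substP-id (liftP-id e) v)
  substP-id e ⟪ m , t ⟫ = cong ⟪ m ,_⟫ (substP-id e t)
  substP-id e (exE t u) = cong₂ exE (substP-id e t) (substP-id (liftP-id (liftNP-cong e)) u)
  substP-id e (Em t u) = cong₂ Em (substP-id e t) (substP-id e u)
  substP-id e (Hyp P) = refl
  substP-id e (Wit P) = refl
  substP-id e TT = refl
  substP-id e (Rec t u m) = cong₂ (λ a b → Rec a b m) (substP-id e t) (substP-id e u)
  substP-id e (rc ts) = cong rc (substPs-id e ts)

  substPs-id : ∀ {ρ} → ρ ≗ pv → ∀ ts → substPs ρ ts ≡ ts
  substPs-id e [] = refl
  substPs-id e (t ∷ ts) = cong₂ _∷_ (substP-id e t) (substPs-id e ts)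

_∷ₚ_ : PT → PSub → PSub
(a ∷ₚ τ) zero = a
(a ∷ₚ τ) (suc i) = τ i

liftP-[] : ∀ a τ t → substP (liftP τ) t [ a ]P ≡ substP (a ∷ₚ τ) t
liftP-[] a τ = substP-∘ λ where
  zero → refl
  (suc i) → trans (substP-renP (λ _ → refl) (τ i)) (substP-id (λ _ → refl) (τ i))

substP-[] : ∀ ρ t u → substP ρ (t [ u ]P) ≡ substP (substP ρ u ∷ₚ ρ) t
substP-[] ρ t u = substP-∘ (λ { zero → refl ; (suc i) → refl }) t

single-liftNP : ∀ m ρ u → substNP (single m) (substP (liftNP ρ) u) ≡ substP ρ (substNP (single m) u)
single-liftNP m ρ = substNP-substP (λ i → single-shiftNP m (ρ i))

single-liftNP-[] : ∀ n τ a t →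
  substNP (single n) (substP (liftP (liftNP τ)) t) [ a ]P ≡ substP (a ∷ₚ τ) (substNP (single n) t)
single-liftNP-[] n τ a t = trans
  (cong (_[ a ]P) (substNP-substP (substNP-liftP (λ i → single-shiftNP n (τ i))) t))
  (liftP-[] a τ (substNP (single n) t))

substNP-[] : ∀ σ u t → substNP σ (u [ t ]P) ≡ substNP σ u [ substNP σ t ]P
substNP-[] σ u t = substNP-substP (λ { zero → refl ; (suc i) → refl }) u

substNP-single : ∀ σ m u →
  substNP σ (substNP (single m) u) ≡ substNP (single (substT σ m)) (substNP (liftS σ) u)
substNP-single σ m u = trans (substNP-∘ (λ _ → refl) u) (sym (substNP-∘ single-liftS u))
  where
  single-liftS : substT (single (substT σ m)) ∘ liftS σ ≗ substT σ ∘ single m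
  single-liftS zero = refl
  single-liftS (suc i) = trans (substT-∘ (λ _ → refl) (σ i)) (substT-id (λ _ → refl) (σ i))

Λ-body-subst : ∀ m σ τ u → substNP (single m) (substP (liftNP τ) (substNP (liftS σ) u))
                             ≡ substP τ (substNP (substT (single m) ∘ liftS σ) u)
Λ-body-subst m σ τ u =
  trans (single-liftNP m τ (substNP (liftS σ) u)) (cong (substP τ) (substNP-∘ (λ _ → refl) u))

exE-body-subst : ∀ n σ τ a t
  → substNP (single n) (substP (liftP (liftNP τ)) (substNP (liftS σ) t)) [ a ]P
    ≡ substP (a ∷ₚ τ) (substNP (substT (single n) ∘ liftS σ) t)
exE-body-subst n σ τ a t =
  trans (single-liftNP-[] n τ a (substNP (liftS σ) t)) (cong (substP (a ∷ₚ τ)) (substNP-∘ (λ _ → refl) t))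

-- H n ⇝ True requires the instance P[n/α] to be true, hence closed, so a later
-- numeric substitution leaves that instance unchanged.
closed-substT : ∀ ρ t {k} → evalTm t ≡ just k → substT ρ t ≡ t
closed-substT ρ (vr i) ()
closed-substT ρ 𝟎 e = refl
closed-substT ρ (𝐒 t) e with evalTm t in et
closed-substT ρ (𝐒 t) e | just _ = cong 𝐒 (closed-substT ρ t et)
closed-substT ρ (𝐒 t) () | nothing

single-liftS-closed : ∀ σ n a {k} → evalTm (substT (single n) a) ≡ just k
  → substT (single (substT σ n)) (substT (liftS σ) a) ≡ substT (single n) a
single-liftS-closed σ n (vr zero) e = closed-substT σ n e
single-liftS-closed σ n (vr (suc i)) ()
single-liftS-closed σ n 𝟎 e = refl
single-liftS-closed σ n (𝐒 a) e with evalTm (substT (single n) a) in ea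
single-liftS-closed σ n (𝐒 a) e | just _ = cong 𝐒 (single-liftS-closed σ n a ea)
single-liftS-closed σ n (𝐒 a) () | nothing

single-liftS-closeds : ∀ {m} σ n (ts : Vec Tm m) {ns}
  → evalTms (Vec.map (substT (single n)) ts) ≡ just ns
  → Vec.map (substT (single (substT σ n))) (Vec.map (substT (liftS σ)) ts)
    ≡ Vec.map (substT (single n)) ts
single-liftS-closeds σ n [] e = refl
single-liftS-closeds σ n (t ∷ ts) e
  with evalTm (substT (single n) t) in et | evalTms (Vec.map (substT (single n)) ts) in ets
single-liftS-closeds σ n (t ∷ ts) e | just _ | just _ =
  cong₂ _∷_ (single-liftS-closed σ n t et) (single-liftS-closeds σ n ts ets)
single-liftS-closeds σ n (t ∷ ts) () | just _ | nothing
single-liftS-closeds σ n (t ∷ ts) () | nothing | _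

TrueA-single-liftS : ∀ σ n P →
  TrueA (substA (single n) P) → TrueA (substA (single (substT σ n)) (substA (liftS σ) P))
TrueA-single-liftS σ n (s ⦅ ts ⦆) (ns , e , h) =
  subst (λ us → TrueA (s ⦅ us ⦆)) (sym (single-liftS-closeds σ n ts e)) (ns , e , h)

IsNum-substT : ∀ σ {n} → IsNum n → IsNum (substT σ n)
IsNum-substT σ num𝟎 = num𝟎
IsNum-substT σ (num𝐒 i) = num𝐒 (IsNum-substT σ i)

⇝-respʳ-≡ : ∀ {a b c} → b ≡ c → a ⇝ b → a ⇝ c
⇝-respʳ-≡ refl r = r

mutual
  substP-⇝ : ∀ ρ {t t'} → t ⇝ t' → substP ρ t ⇝ substP ρ t'
  substP-⇝ ρ (βλ {u} {t}) = ⇝-respʳ-≡ (trans (liftP-[] _ ρ u) (sym (substP-[] ρ u t))) βλ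
  substP-⇝ ρ (βΛ {u} {m}) = ⇝-respʳ-≡ (single-liftNP m ρ u) βΛ
  substP-⇝ ρ βπ₀ = βπ₀
  substP-⇝ ρ βπ₁ = βπ₁
  substP-⇝ ρ (βinj₀ {u} {t₀}) =
    ⇝-respʳ-≡ (trans (liftP-[] _ ρ t₀) (sym (substP-[] ρ t₀ u))) βinj₀
  substP-⇝ ρ (βinj₁ {u} {_} {t₁}) =
    ⇝-respʳ-≡ (trans (liftP-[] _ ρ t₁) (sym (substP-[] ρ t₁ u))) βinj₁
  substP-⇝ ρ (β∃ {n} {u} {v} isn) =
    ⇝-respʳ-≡ (trans (single-liftNP-[] n ρ _ v) (sym (substP-[] ρ (substNP (single n) v) u)))
      (β∃ isn)
  substP-⇝ ρ βR0 = βR0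
  substP-⇝ ρ (βRS isn) = βRS isn
  substP-⇝ ρ E· = E·
  substP-⇝ ρ E·ₙ = E·ₙ
  substP-⇝ ρ Eπ₀ = Eπ₀
  substP-⇝ ρ Eπ₁ = Eπ₁
  substP-⇝ ρ Ecase = Ecase
  substP-⇝ ρ EexE = EexE
  substP-⇝ ρ (βH h) = βH h
  substP-⇝ ρ (βW isn) = βW isn
  substP-⇝ ρ E₀ = E₀
  substP-⇝ ρ E₁ = E₁
  substP-⇝ ρ (·ˡ r) = ·ˡ (substP-⇝ ρ r)
  substP-⇝ ρ (·ʳ r) = ·ʳ (substP-⇝ ρ r)
  substP-⇝ ρ (·ₙˡ r) = ·ₙˡ (substP-⇝ ρ r)
  substP-⇝ ρ (ƛc r) = ƛc (substP-⇝ (liftP ρ) r)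
  substP-⇝ ρ (Λc r) = Λc (substP-⇝ (liftNP ρ) r)
  substP-⇝ ρ (⟨⟩ˡ r) = ⟨⟩ˡ (substP-⇝ ρ r)
  substP-⇝ ρ (⟨⟩ʳ r) = ⟨⟩ʳ (substP-⇝ ρ r)
  substP-⇝ ρ (π₀c r) = π₀c (substP-⇝ ρ r)
  substP-⇝ ρ (π₁c r) = π₁c (substP-⇝ ρ r)
  substP-⇝ ρ (inj₀c r) = inj₀c (substP-⇝ ρ r)
  substP-⇝ ρ (inj₁c r) = inj₁c (substP-⇝ ρ r)
  substP-⇝ ρ (case₁ r) = case₁ (substP-⇝ ρ r)
  substP-⇝ ρ (case₂ r) = case₂ (substP-⇝ (liftP ρ) r)
  substP-⇝ ρ (case₃ r) = case₃ (substP-⇝ (liftP ρ) r)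
  substP-⇝ ρ (⟪⟫c r) = ⟪⟫c (substP-⇝ ρ r)
  substP-⇝ ρ (exE₁ r) = exE₁ (substP-⇝ ρ r)
  substP-⇝ ρ (exE₂ r) = exE₂ (substP-⇝ (liftP (liftNP ρ)) r)
  substP-⇝ ρ (Emˡ r) = Emˡ (substP-⇝ ρ r)
  substP-⇝ ρ (Emʳ r) = Emʳ (substP-⇝ ρ r)
  substP-⇝ ρ (Rec₁ r) = Rec₁ (substP-⇝ ρ r)
  substP-⇝ ρ (Rec₂ r) = Rec₂ (substP-⇝ ρ r)
  substP-⇝ ρ (rcc r) = rcc (substPs-⇝ₗ ρ r)

  substPs-⇝ₗ : ∀ ρ {ts ts'} → ts ⇝ₗ ts' → substPs ρ ts ⇝ₗ substPs ρ ts'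
  substPs-⇝ₗ ρ (hd r) = hd (substP-⇝ ρ r)
  substPs-⇝ₗ ρ (tl r) = tl (substPs-⇝ₗ ρ r)

mutual
  substNP-⇝ : ∀ σ {t t'} → t ⇝ t' → substNP σ t ⇝ substNP σ t'
  substNP-⇝ σ (βλ {u} {t}) = ⇝-respʳ-≡ (sym (substNP-[] σ u t)) βλ
  substNP-⇝ σ (βΛ {u} {m}) = ⇝-respʳ-≡ (sym (substNP-single σ m u)) βΛ
  substNP-⇝ σ βπ₀ = βπ₀
  substNP-⇝ σ βπ₁ = βπ₁
  substNP-⇝ σ (βinj₀ {u} {t₀}) = ⇝-respʳ-≡ (sym (substNP-[] σ t₀ u)) βinj₀
  substNP-⇝ σ (βinj₁ {u} {_} {t₁}) = ⇝-respʳ-≡ (sym (substNP-[] σ t₁ u)) βinj₁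
  substNP-⇝ σ (β∃ {n} {u} {v} isn) =
    ⇝-respʳ-≡ (sym (trans (substNP-[] σ (substNP (single n) v) u)
                          (cong (_[ substNP σ u ]P) (substNP-single σ n v))))
      (β∃ (IsNum-substT σ isn))
  substNP-⇝ σ βR0 = βR0
  substNP-⇝ σ (βRS isn) = βRS (IsNum-substT σ isn)
  substNP-⇝ σ E· = E·
  substNP-⇝ σ E·ₙ = E·ₙ
  substNP-⇝ σ Eπ₀ = Eπ₀
  substNP-⇝ σ Eπ₁ = Eπ₁
  substNP-⇝ σ Ecase = Ecase
  substNP-⇝ σ EexE = EexE
  substNP-⇝ σ (βH {P} {n} h) = βH (TrueA-single-liftS σ n P h)
  substNP-⇝ σ (βW isn) = βW (IsNum-substT σ isn)
  substNP-⇝ σ E₀ = E₀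
  substNP-⇝ σ E₁ = E₁
  substNP-⇝ σ (·ˡ r) = ·ˡ (substNP-⇝ σ r)
  substNP-⇝ σ (·ʳ r) = ·ʳ (substNP-⇝ σ r)
  substNP-⇝ σ (·ₙˡ r) = ·ₙˡ (substNP-⇝ σ r)
  substNP-⇝ σ (ƛc r) = ƛc (substNP-⇝ σ r)
  substNP-⇝ σ (Λc r) = Λc (substNP-⇝ (liftS σ) r)
  substNP-⇝ σ (⟨⟩ˡ r) = ⟨⟩ˡ (substNP-⇝ σ r)
  substNP-⇝ σ (⟨⟩ʳ r) = ⟨⟩ʳ (substNP-⇝ σ r)
  substNP-⇝ σ (π₀c r) = π₀c (substNP-⇝ σ r)
  substNP-⇝ σ (π₁c r) = π₁c (substNP-⇝ σ r)
  substNP-⇝ σ (inj₀c r) = inj₀c (substNP-⇝ σ r)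
  substNP-⇝ σ (inj₁c r) = inj₁c (substNP-⇝ σ r)
  substNP-⇝ σ (case₁ r) = case₁ (substNP-⇝ σ r)
  substNP-⇝ σ (case₂ r) = case₂ (substNP-⇝ σ r)
  substNP-⇝ σ (case₃ r) = case₃ (substNP-⇝ σ r)
  substNP-⇝ σ (⟪⟫c r) = ⟪⟫c (substNP-⇝ σ r)
  substNP-⇝ σ (exE₁ r) = exE₁ (substNP-⇝ σ r)
  substNP-⇝ σ (exE₂ r) = exE₂ (substNP-⇝ (liftS σ) r)
  substNP-⇝ σ (Emˡ r) = Emˡ (substNP-⇝ σ r)
  substNP-⇝ σ (Emʳ r) = Emʳ (substNP-⇝ σ r)
  substNP-⇝ σ (Rec₁ r) = Rec₁ (substNP-⇝ σ r)
  substNP-⇝ σ (Rec₂ r) = Rec₂ (substNP-⇝ σ r)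
  substNP-⇝ σ (rcc r) = rcc (substNPs-⇝ₗ σ r)

  substNPs-⇝ₗ : ∀ σ {ts ts'} → ts ⇝ₗ ts' → substNPs σ ts ⇝ₗ substNPs σ ts'
  substNPs-⇝ₗ σ (hd r) = hd (substNP-⇝ σ r)
  substNPs-⇝ₗ σ (tl r) = tl (substNPs-⇝ₗ σ r)

SN-substP⁻¹ : ∀ ρ {t} → SN (substP ρ t) → SN t
SN-substP⁻¹ ρ (sn f) = sn (λ r → SN-substP⁻¹ ρ (f (substP-⇝ ρ r)))

SN-substNP⁻¹ : ∀ σ {t} → SN (substNP σ t) → SN t
SN-substNP⁻¹ σ (sn f) = sn (λ r → SN-substNP⁻¹ σ (f (substNP-⇝ σ r)))

infixr 5 _⊗_ _⊕_ _⇛_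
data Ty : Set where
  base : Ty
  _⊗_ _⊕_ _⇛_ : Ty → Ty → Ty
  ∀T ∃T : Ty → Ty

⟦_⟧ : Ty → PT → Set
⟦ base ⟧ t = SN t
⟦ A ⊗ B ⟧ t = ⟦ A ⟧ (π₀ t) × ⟦ B ⟧ (π₁ t)
⟦ A ⇛ B ⟧ t = ∀ u → ⟦ A ⟧ u → ⟦ B ⟧ (t · u)
⟦ A ⊕ B ⟧ t = SN t × (∀ u → t ⇝* inj₀ u → ⟦ A ⟧ u) × (∀ u → t ⇝* inj₁ u → ⟦ B ⟧ u)
⟦ ∀T A ⟧ t = ∀ n → ⟦ A ⟧ (t ·ₙ n)
⟦ ∃T A ⟧ t = SN t × (∀ n u → t ⇝* ⟪ n , u ⟫ → ⟦ A ⟧ u)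

Reducts : Ty → PT → Set
Reducts A t = ∀ {t'} → t ⇝ t' → ⟦ A ⟧ t'

-- Neither an introduction nor E(_, _): an eliminator applied to a neutral term
-- can only reduce inside its arguments.
data Neutral : PT → Set where
  pv  : ∀ {i} → Neutral (pv i)
  _·_ : ∀ {t u} → Neutral (t · u)
  _·ₙ_ : ∀ {t m} → Neutral (t ·ₙ m)
  π₀  : ∀ {t} → Neutral (π₀ t)
  π₁  : ∀ {t} → Neutral (π₁ t)
  case : ∀ {t u v} → Neutral (case t u v)
  exE : ∀ {t u} → Neutral (exE t u)
  Rec : ∀ {t u m} → Neutral (Rec t u m)

SN-⇝ : ∀ {t t'} → SN t → t ⇝ t' → SN t'
SN-⇝ (sn f) r = f r

SN-⇝* : ∀ {t t'} → SN t → t ⇝* t' → SN t'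
SN-⇝* s ε = s
SN-⇝* s (r ◅ rs) = SN-⇝* (SN-⇝ s r) rs

SN-·⁻¹ : ∀ {t u} → SN (t · u) → SN t
SN-·⁻¹ (sn f) = sn (λ r → SN-·⁻¹ (f (·ˡ r)))

SN-·ₙ⁻¹ : ∀ {t m} → SN (t ·ₙ m) → SN t
SN-·ₙ⁻¹ (sn f) = sn (λ r → SN-·ₙ⁻¹ (f (·ₙˡ r)))

SN-π₀⁻¹ : ∀ {t} → SN (π₀ t) → SN t
SN-π₀⁻¹ (sn f) = sn (λ r → SN-π₀⁻¹ (f (π₀c r)))

mutual
  CR1 : ∀ A {t} → ⟦ A ⟧ t → SN t
  CR1 base r = r
  CR1 (A ⊗ B) (ra , _) = SN-π₀⁻¹ (CR1 A ra)
  CR1 (A ⇛ B) h = SN-·⁻¹ (CR1 B (h (pv 0) (var-⟦⟧ A)))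
  CR1 (A ⊕ B) (s , _) = s
  CR1 (∀T A) h = SN-·ₙ⁻¹ (CR1 A (h 𝟎))
  CR1 (∃T A) (s , _) = s

  var-⟦⟧ : ∀ A {i} → ⟦ A ⟧ (pv i)
  var-⟦⟧ A = CR3 A pv (λ ())

  CR2 : ∀ A {t t'} → ⟦ A ⟧ t → t ⇝ t' → ⟦ A ⟧ t'
  CR2 base s r = SN-⇝ s r
  CR2 (A ⊗ B) (ra , rb) r = CR2 A ra (π₀c r) , CR2 B rb (π₁c r)
  CR2 (A ⇛ B) h r = λ u ru → CR2 B (h u ru) (·ˡ r)
  CR2 (A ⊕ B) (s , h₀ , h₁) r =
    SN-⇝ s r , (λ u rs → h₀ u (r ◅ rs)) , (λ u rs → h₁ u (r ◅ rs))
  CR2 (∀T A) h r = λ n → CR2 A (h n) (·ₙˡ r)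
  CR2 (∃T A) (s , h) r = SN-⇝ s r , (λ n u rs → h n u (r ◅ rs))

  CR3 : ∀ A {t} → Neutral t → Reducts A t → ⟦ A ⟧ t
  CR3 base _ h = sn h
  CR3 (A ⊗ B) nt h = CR3 A π₀ (π₀-neutral nt h) , CR3 B π₁ (π₁-neutral nt h)
  CR3 (A ⇛ B) nt h u ru = ·-neutral A B nt h ru (CR1 A ru)
  CR3 (A ⊕ B) nt h = sn (λ r → proj₁ (h r)) , ⊕₀-neutral nt h , ⊕₁-neutral nt h
  CR3 (∀T A) nt h n = CR3 A _·ₙ_ (·ₙ-neutral A nt h n)
  CR3 (∃T A) nt h = sn (λ r → proj₁ (h r)) , ∃-neutral nt h

  π₀-neutral : ∀ {A B t} → Neutral t → Reducts (A ⊗ B) t → Reducts A (π₀ t)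
  π₀-neutral () h βπ₀
  π₀-neutral () h Eπ₀
  π₀-neutral nt h (π₀c r) = proj₁ (h r)

  π₁-neutral : ∀ {A B t} → Neutral t → Reducts (A ⊗ B) t → Reducts B (π₁ t)
  π₁-neutral () h βπ₁
  π₁-neutral () h Eπ₁
  π₁-neutral nt h (π₁c r) = proj₂ (h r)

  ·-neutral : ∀ A B {t u} → Neutral t → Reducts (A ⇛ B) t → ⟦ A ⟧ u → SN u → ⟦ B ⟧ (t · u)
  ·-neutral A B nt h ru (sn f) = CR3 B _·_ (reducts nt)
    where
    reducts : Neutral _ → Reducts B (_ · _)
    reducts () βλ
    reducts () E·
    reducts _ (·ˡ r) = h r _ ru
    reducts _ (·ʳ r) = ·-neutral A B nt h (CR2 A ru r) (f r)

  ·ₙ-neutral : ∀ A {t} → Neutral t → Reducts (∀T A) t → ∀ n → Reducts A (t ·ₙ n)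
  ·ₙ-neutral A () h n βΛ
  ·ₙ-neutral A () h n E·ₙ
  ·ₙ-neutral A () h n (βH _)
  ·ₙ-neutral A nt h n (·ₙˡ r) = h r n

  ⊕₀-neutral : ∀ {A B t} → Neutral t → Reducts (A ⊕ B) t → ∀ u → t ⇝* inj₀ u → ⟦ A ⟧ u
  ⊕₀-neutral () h u ε
  ⊕₀-neutral nt h u (r ◅ rs) = proj₁ (proj₂ (h r)) u rs

  ⊕₁-neutral : ∀ {A B t} → Neutral t → Reducts (A ⊕ B) t → ∀ u → t ⇝* inj₁ u → ⟦ B ⟧ u
  ⊕₁-neutral () h u ε
  ⊕₁-neutral nt h u (r ◅ rs) = proj₂ (proj₂ (h r)) u rs

  ∃-neutral : ∀ {A t} → Neutral t → Reducts (∃T A) t → ∀ n u → t ⇝* ⟪ n , u ⟫ → ⟦ A ⟧ u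
  ∃-neutral () h n u ε
  ∃-neutral nt h n u (r ◅ rs) = proj₂ (h r) n u rs

CR2* : ∀ A {t t'} → ⟦ A ⟧ t → t ⇝* t' → ⟦ A ⟧ t'
CR2* A x ε = x
CR2* A x (r ◅ rs) = CR2* A (CR2 A x r) rs

SN-Em : ∀ {u v} → SN u → SN v → SN (Em u v)
SN-Em su@(sn f) sv@(sn g) = sn λ where
  E₀ → su
  E₁ → sv
  (Emˡ r) → SN-Em (f r) sv
  (Emʳ r) → SN-Em su (g r)

Em-⇝*-branch : ∀ {u v s} → (∀ {a b} → s ≡ Em a b → ⊥) →
               Em u v ⇝* s → u ⇝* s ⊎ v ⇝* s
Em-⇝*-branch notEm ε = ⊥-elim (notEm refl)
Em-⇝*-branch notEm (E₀ ◅ rs) = inj₁ rs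
Em-⇝*-branch notEm (E₁ ◅ rs) = inj₂ rs
Em-⇝*-branch notEm (Emˡ r ◅ rs) = map₁ (r ◅_) (Em-⇝*-branch notEm rs)
Em-⇝*-branch notEm (Emʳ r ◅ rs) = map₂ (r ◅_) (Em-⇝*-branch notEm rs)

mutual
  Em-⟦⟧ : ∀ A {u v} → ⟦ A ⟧ u → ⟦ A ⟧ v → ⟦ A ⟧ (Em u v)
  Em-⟦⟧ base su sv = SN-Em su sv
  Em-⟦⟧ (A ⊗ B) ru rv =
    π₀-Em A B ru rv (CR1 (A ⊗ B) ru) (CR1 (A ⊗ B) rv) ,
    π₁-Em A B ru rv (CR1 (A ⊗ B) ru) (CR1 (A ⊗ B) rv)
  Em-⟦⟧ (A ⇛ B) ru rv w rw = ·-Em A B ru rv (CR1 (A ⇛ B) ru) (CR1 (A ⇛ B) rv) rw (CR1 A rw)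
  Em-⟦⟧ (A ⊕ B) (su , ru₀ , ru₁) (sv , rv₀ , rv₁) = SN-Em su sv
    , (λ w rs → [ ru₀ w , rv₀ w ] (Em-⇝*-branch (λ ()) rs))
    , (λ w rs → [ ru₁ w , rv₁ w ] (Em-⇝*-branch (λ ()) rs))
  Em-⟦⟧ (∀T A) ru rv n = ·ₙ-Em A ru rv (CR1 (∀T A) ru) (CR1 (∀T A) rv) n
  Em-⟦⟧ (∃T A) (su , ru) (sv , rv) = SN-Em su sv
    , (λ n w rs → [ ru n w , rv n w ] (Em-⇝*-branch (λ ()) rs))

  π₀-Em : ∀ A B {u v} → ⟦ A ⊗ B ⟧ u → ⟦ A ⊗ B ⟧ v → SN u → SN v → ⟦ A ⟧ (π₀ (Em u v))
  π₀-Em A B ru rv (sn f) (sn g) = CR3 A π₀ λ where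
    Eπ₀ → Em-⟦⟧ A (proj₁ ru) (proj₁ rv)
    (π₀c E₀) → proj₁ ru
    (π₀c E₁) → proj₁ rv
    (π₀c (Emˡ r)) → π₀-Em A B (CR2 (A ⊗ B) ru r) rv (f r) (sn g)
    (π₀c (Emʳ r)) → π₀-Em A B ru (CR2 (A ⊗ B) rv r) (sn f) (g r)

  π₁-Em : ∀ A B {u v} → ⟦ A ⊗ B ⟧ u → ⟦ A ⊗ B ⟧ v → SN u → SN v → ⟦ B ⟧ (π₁ (Em u v))
  π₁-Em A B ru rv (sn f) (sn g) = CR3 B π₁ λ where
    Eπ₁ → Em-⟦⟧ B (proj₂ ru) (proj₂ rv)
    (π₁c E₀) → proj₂ ru
    (π₁c E₁) → proj₂ rv
    (π₁c (Emˡ r)) → π₁-Em A B (CR2 (A ⊗ B) ru r) rv (f r) (sn g)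
    (π₁c (Emʳ r)) → π₁-Em A B ru (CR2 (A ⊗ B) rv r) (sn f) (g r)

  ·-Em : ∀ A B {u v w} → ⟦ A ⇛ B ⟧ u → ⟦ A ⇛ B ⟧ v → SN u → SN v →
         ⟦ A ⟧ w → SN w → ⟦ B ⟧ (Em u v · w)
  ·-Em A B ru rv (sn f) (sn g) rw (sn h) = CR3 B _·_ λ where
    E· → Em-⟦⟧ B (ru _ rw) (rv _ rw)
    (·ˡ E₀) → ru _ rw
    (·ˡ E₁) → rv _ rw
    (·ˡ (Emˡ r)) → ·-Em A B (CR2 (A ⇛ B) ru r) rv (f r) (sn g) rw (sn h)
    (·ˡ (Emʳ r)) → ·-Em A B ru (CR2 (A ⇛ B) rv r) (sn f) (g r) rw (sn h)
    (·ʳ r) → ·-Em A B ru rv (sn f) (sn g) (CR2 A rw r) (h r)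

  ·ₙ-Em : ∀ A {u v} → ⟦ ∀T A ⟧ u → ⟦ ∀T A ⟧ v → SN u → SN v → ∀ n → ⟦ A ⟧ (Em u v ·ₙ n)
  ·ₙ-Em A ru rv (sn f) (sn g) n = CR3 A _·ₙ_ λ where
    E·ₙ → Em-⟦⟧ A (ru n) (rv n)
    (·ₙˡ E₀) → ru n
    (·ₙˡ E₁) → rv n
    (·ₙˡ (Emˡ r)) → ·ₙ-Em A (CR2 (∀T A) ru r) rv (f r) (sn g) n
    (·ₙˡ (Emʳ r)) → ·ₙ-Em A ru (CR2 (∀T A) rv r) (sn f) (g r) n

⟦_↦_⟧ : Ty → Ty → PT → Set
⟦ A ↦ C ⟧ w = ∀ a → ⟦ A ⟧ a → ⟦ C ⟧ (w [ a ]P)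

↦-SN : ∀ A C {w} → ⟦ A ↦ C ⟧ w → SN w
↦-SN A C h = SN-substP⁻¹ (singleP (pv 0)) (CR1 C (h (pv 0) (var-⟦⟧ A)))

↦-⇝ : ∀ A C {w w'} → ⟦ A ↦ C ⟧ w → w ⇝ w' → ⟦ A ↦ C ⟧ w'
↦-⇝ A C h r a ra = CR2 C (h a ra) (substP-⇝ (singleP a) r)

ƛ-⟦⟧ : ∀ A B {b} → ⟦ A ↦ B ⟧ b → ⟦ A ⇛ B ⟧ (ƛ b)
ƛ-⟦⟧ A B h a ra = go h (↦-SN A B h) ra (CR1 A ra)
  where
  go : ∀ {b a} → ⟦ A ↦ B ⟧ b → SN b → ⟦ A ⟧ a → SN a → ⟦ B ⟧ ((ƛ b) · a)
  go h (sn fb) ra (sn fa) = CR3 B _·_ λ where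
    βλ → h _ ra
    (·ˡ (ƛc r)) → go (↦-⇝ A B h r) (fb r) ra (sn fa)
    (·ʳ r) → go h (sn fb) (CR2 A ra r) (fa r)

Λ-⟦⟧ : ∀ A {b} → (∀ m → ⟦ A ⟧ (substNP (single m) b)) → ⟦ ∀T A ⟧ (Λ b)
Λ-⟦⟧ A h = go h (SN-substNP⁻¹ (single 𝟎) (CR1 A (h 𝟎)))
  where
  go : ∀ {b} → (∀ m → ⟦ A ⟧ (substNP (single m) b)) → SN b → ⟦ ∀T A ⟧ (Λ b)
  go h (sn f) m = CR3 A _·ₙ_ λ where
    βΛ → h m
    (·ₙˡ (Λc r)) → go (λ m' → CR2 A (h m') (substNP-⇝ (single m') r)) (f r) m

π₀-pair : ∀ A {a b} → ⟦ A ⟧ a → SN a → SN b → ⟦ A ⟧ (π₀ ⟨ a , b ⟩)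
π₀-pair A ra (sn f) (sn g) = CR3 A π₀ λ where
  βπ₀ → ra
  (π₀c (⟨⟩ˡ r)) → π₀-pair A (CR2 A ra r) (f r) (sn g)
  (π₀c (⟨⟩ʳ r)) → π₀-pair A ra (sn f) (g r)

π₁-pair : ∀ B {a b} → ⟦ B ⟧ b → SN a → SN b → ⟦ B ⟧ (π₁ ⟨ a , b ⟩)
π₁-pair B rb (sn f) (sn g) = CR3 B π₁ λ where
  βπ₁ → rb
  (π₁c (⟨⟩ˡ r)) → π₁-pair B rb (f r) (sn g)
  (π₁c (⟨⟩ʳ r)) → π₁-pair B (CR2 B rb r) (sn f) (g r)

pair-⟦⟧ : ∀ A B {a b} → ⟦ A ⟧ a → ⟦ B ⟧ b → ⟦ A ⊗ B ⟧ ⟨ a , b ⟩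
pair-⟦⟧ A B ra rb = π₀-pair A ra (CR1 A ra) (CR1 B rb) , π₁-pair B rb (CR1 A ra) (CR1 B rb)

SN-inj₀ : ∀ {a} → SN a → SN (inj₀ a)
SN-inj₀ (sn f) = sn λ { (inj₀c r) → SN-inj₀ (f r) }

SN-inj₁ : ∀ {a} → SN a → SN (inj₁ a)
SN-inj₁ (sn f) = sn λ { (inj₁c r) → SN-inj₁ (f r) }

SN-⟪⟫ : ∀ {m a} → SN a → SN ⟪ m , a ⟫
SN-⟪⟫ (sn f) = sn λ { (⟪⟫c r) → SN-⟪⟫ (f r) }

SN-⟪⟫⁻¹ : ∀ {m a} → SN ⟪ m , a ⟫ → SN a
SN-⟪⟫⁻¹ (sn f) = sn (λ r → SN-⟪⟫⁻¹ (f (⟪⟫c r)))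

inj₀-⇝* : ∀ {a s} → inj₀ a ⇝* s → ∃[ a' ] a ⇝* a' × s ≡ inj₀ a'
inj₀-⇝* ε = _ , ε , refl
inj₀-⇝* (inj₀c r ◅ rs) = let a' , rs' , e = inj₀-⇝* rs in a' , r ◅ rs' , e

inj₁-⇝* : ∀ {a s} → inj₁ a ⇝* s → ∃[ a' ] a ⇝* a' × s ≡ inj₁ a'
inj₁-⇝* ε = _ , ε , refl
inj₁-⇝* (inj₁c r ◅ rs) = let a' , rs' , e = inj₁-⇝* rs in a' , r ◅ rs' , e

⟪⟫-⇝* : ∀ {m a s} → ⟪ m , a ⟫ ⇝* s → ∃[ a' ] a ⇝* a' × s ≡ ⟪ m , a' ⟫
⟪⟫-⇝* ε = _ , ε , refl
⟪⟫-⇝* (⟪⟫c r ◅ rs) = let a' , rs' , e = ⟪⟫-⇝* rs in a' , r ◅ rs' , e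

inj₀-⟦⟧ : ∀ A B {a} → ⟦ A ⟧ a → ⟦ A ⊕ B ⟧ (inj₀ a)
inj₀-⟦⟧ A B ra = SN-inj₀ (CR1 A ra)
  , (λ u rs → case inj₀-⇝* rs of λ { (_ , rs' , refl) → CR2* A ra rs' })
  , (λ u rs → case inj₀-⇝* rs of λ { (_ , _ , ()) })

inj₁-⟦⟧ : ∀ A B {a} → ⟦ B ⟧ a → ⟦ A ⊕ B ⟧ (inj₁ a)
inj₁-⟦⟧ A B ra = SN-inj₁ (CR1 B ra)
  , (λ u rs → case inj₁-⇝* rs of λ { (_ , _ , ()) })
  , (λ u rs → case inj₁-⇝* rs of λ { (_ , rs' , refl) → CR2* B ra rs' })

⟪⟫-⟦⟧ : ∀ A {m a} → ⟦ A ⟧ a → ⟦ ∃T A ⟧ ⟪ m , a ⟫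
⟪⟫-⟦⟧ A ra = SN-⟪⟫ (CR1 A ra)
  , (λ n u rs → case ⟪⟫-⇝* rs of λ { (_ , rs' , refl) → CR2* A ra rs' })

case-⟦⟧ : ∀ A B C {t w₁ w₂} →
          ⟦ A ⊕ B ⟧ t → ⟦ A ↦ C ⟧ w₁ → ⟦ B ↦ C ⟧ w₂ → ⟦ C ⟧ (case t w₁ w₂)
case-⟦⟧ A B C rt h₁ h₂ = go rt h₁ h₂ (CR1 (A ⊕ B) rt) (↦-SN A C h₁) (↦-SN B C h₂)
  where
  go : ∀ {t w₁ w₂} → ⟦ A ⊕ B ⟧ t → ⟦ A ↦ C ⟧ w₁ → ⟦ B ↦ C ⟧ w₂
    → SN t → SN w₁ → SN w₂ → ⟦ C ⟧ (case t w₁ w₂)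
  go rt h₁ h₂ (sn ft) (sn f₁) (sn f₂) = CR3 C case λ where
    βinj₀ → h₁ _ (proj₁ (proj₂ rt) _ ε)
    βinj₁ → h₂ _ (proj₂ (proj₂ rt) _ ε)
    Ecase → Em-⟦⟧ C (go (CR2 (A ⊕ B) rt E₀) h₁ h₂ (ft E₀) (sn f₁) (sn f₂))
                    (go (CR2 (A ⊕ B) rt E₁) h₁ h₂ (ft E₁) (sn f₁) (sn f₂))
    (case₁ r) → go (CR2 (A ⊕ B) rt r) h₁ h₂ (ft r) (sn f₁) (sn f₂)
    (case₂ r) → go rt (↦-⇝ A C h₁ r) h₂ (sn ft) (f₁ r) (sn f₂)
    (case₃ r) → go rt h₁ (↦-⇝ B C h₂ r) (sn ft) (sn f₁) (f₂ r)

exE-⟦⟧ : ∀ A C {t v} →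
         ⟦ ∃T A ⟧ t → (∀ n → ⟦ A ↦ C ⟧ (substNP (single n) v)) → ⟦ C ⟧ (exE t v)
exE-⟦⟧ A C rt h = go rt h (CR1 (∃T A) rt) (SN-substNP⁻¹ (single 𝟎) (↦-SN A C (h 𝟎)))
  where
  go : ∀ {t v} → ⟦ ∃T A ⟧ t → (∀ n → ⟦ A ↦ C ⟧ (substNP (single n) v))
    → SN t → SN v → ⟦ C ⟧ (exE t v)
  go rt h (sn ft) (sn fv) = CR3 C exE λ where
    (β∃ _) → h _ _ (proj₂ rt _ _ ε)
    EexE → Em-⟦⟧ C (go (CR2 (∃T A) rt E₀) h (ft E₀) (sn fv))
                   (go (CR2 (∃T A) rt E₁) h (ft E₁) (sn fv))
    (exE₁ r) → go (CR2 (∃T A) rt r) h (ft r) (sn fv)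
    (exE₂ r) → go rt (λ n → ↦-⇝ A C (h n) (substNP-⇝ (single n) r)) (sn ft) (fv r)

Rec-⟦⟧ : ∀ A m {u v} → ⟦ A ⟧ u → ⟦ ∀T (A ⇛ A) ⟧ v → ⟦ A ⟧ (Rec u v m)
Rec-⟦⟧ A m ru rv = go m ru rv (CR1 A ru) (CR1 (∀T (A ⇛ A)) rv)
  where
  go : ∀ m {u v} → ⟦ A ⟧ u → ⟦ ∀T (A ⇛ A) ⟧ v → SN u → SN v → ⟦ A ⟧ (Rec u v m)
  go m ru rv (sn fu) (sn fv) = CR3 A Rec (reducts m)
    where
    reducts : ∀ m {t'} → Rec _ _ m ⇝ t' → ⟦ A ⟧ t'
    reducts 𝟎 βR0 = ru
    reducts (𝐒 n) (βRS _) = rv n _ (go n ru rv (sn fu) (sn fv))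
    reducts m (Rec₁ r) = go m (CR2 A ru r) rv (fu r) (sn fv)
    reducts m (Rec₂ r) = go m ru (CR2 (∀T (A ⇛ A)) rv r) (sn fu) (fv r)

Hyp-⟦⟧ : ∀ P → ⟦ ∀T base ⟧ (Hyp P)
Hyp-⟦⟧ P n = sn λ { (βH _) → sn λ () ; (·ₙˡ ()) }

Wit-⟦⟧ : ∀ P → ⟦ ∃T base ⟧ (Wit P)
Wit-⟦⟧ P = SN-Wit , (λ n u rs → SN-⟪⟫⁻¹ (SN-⇝* SN-Wit rs))
  where
  SN-Wit : SN (Wit P)
  SN-Wit = sn λ { (βW _) → SN-⟪⟫ (sn λ ()) }

SN-rc-∷ : ∀ {t ts} → SN t → SN (rc ts) → SN (rc (t ∷ ts))
SN-rc-∷ (sn f) (sn g) = sn λ where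
  (rcc (hd r)) → SN-rc-∷ (f r) (sn g)
  (rcc (tl r)) → SN-rc-∷ (sn f) (g (rcc r))

SN-rc : ∀ {ts} → All SN ts → SN (rc ts)
SN-rc [] = sn λ { (rcc ()) }
SN-rc (s ∷ ss) = SN-rc-∷ s (SN-rc ss)

skeleton : Fm → Ty
skeleton (atm P) = base
skeleton (A ∧' B) = skeleton A ⊗ skeleton B
skeleton (A ∨' B) = skeleton A ⊕ skeleton B
skeleton (A ⇒ B) = skeleton A ⇛ skeleton B
skeleton (∀' A) = ∀T (skeleton A)
skeleton (∃' A) = ∃T (skeleton A)

skeleton-substF : ∀ σ A → skeleton (substF σ A) ≡ skeleton A
skeleton-substF σ (atm P) = refl
skeleton-substF σ (A ∧' B) = cong₂ _⊗_ (skeleton-substF σ A) (skeleton-substF σ B)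
skeleton-substF σ (A ∨' B) = cong₂ _⊕_ (skeleton-substF σ A) (skeleton-substF σ B)
skeleton-substF σ (A ⇒ B) = cong₂ _⇛_ (skeleton-substF σ A) (skeleton-substF σ B)
skeleton-substF σ (∀' A) = cong ∀T (skeleton-substF (liftS σ) A)
skeleton-substF σ (∃' A) = cong ∃T (skeleton-substF (liftS σ) A)

⟦⟧-resp-≡ : ∀ {S T t} → S ≡ T → ⟦ S ⟧ t → ⟦ T ⟧ t
⟦⟧-resp-≡ refl r = r

mutual
  Red⇒⟦⟧ : ∀ A σ {t} → Red A σ t → ⟦ skeleton A ⟧ t
  Red⇒⟦⟧ (atm P) σ s = s
  Red⇒⟦⟧ (A ∧' B) σ (ra , rb) = Red⇒⟦⟧ A σ ra , Red⇒⟦⟧ B σ rb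
  Red⇒⟦⟧ (A ∨' B) σ (s , h₀ , h₁) =
    s , (λ u rs → Red⇒⟦⟧ A σ (h₀ u rs)) , (λ u rs → Red⇒⟦⟧ B σ (h₁ u rs))
  Red⇒⟦⟧ (A ⇒ B) σ h = λ u ru → Red⇒⟦⟧ B σ (h u (⟦⟧⇒Red A σ ru))
  Red⇒⟦⟧ (∀' A) σ h = λ n → Red⇒⟦⟧ A (n ∷ₛ σ) (h n)
  Red⇒⟦⟧ (∃' A) σ (s , h) = s , (λ n u rs → Red⇒⟦⟧ A (n ∷ₛ σ) (h n u rs))

  ⟦⟧⇒Red : ∀ A σ {t} → ⟦ skeleton A ⟧ t → Red A σ t
  ⟦⟧⇒Red (atm P) σ s = s
  ⟦⟧⇒Red (A ∧' B) σ (ra , rb) = ⟦⟧⇒Red A σ ra , ⟦⟧⇒Red B σ rb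
  ⟦⟧⇒Red (A ∨' B) σ (s , h₀ , h₁) =
    s , (λ u rs → ⟦⟧⇒Red A σ (h₀ u rs)) , (λ u rs → ⟦⟧⇒Red B σ (h₁ u rs))
  ⟦⟧⇒Red (A ⇒ B) σ h = λ u ru → ⟦⟧⇒Red B σ (h u (Red⇒⟦⟧ A σ ru))
  ⟦⟧⇒Red (∀' A) σ h = λ n → ⟦⟧⇒Red A (n ∷ₛ σ) (h n)
  ⟦⟧⇒Red (∃' A) σ (s , h) = s , (λ n u rs → ⟦⟧⇒Red A (n ∷ₛ σ) (h n u rs))

infix 4 _⊨_
_⊨_ : PSub → Ctx → Set
τ ⊨ Γ = ∀ {i B} → Γ ∋ i ⦂ B → ⟦ skeleton B ⟧ (τ i)

⊨-∷ : ∀ {Γ τ A a} → τ ⊨ Γ → ⟦ skeleton A ⟧ a → (a ∷ₚ τ) ⊨ pf A ∷ Γ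
⊨-∷ g ra here = ra
⊨-∷ g ra (thereP x) = g x

⊨-hy : ∀ {Γ τ A} → τ ⊨ Γ → τ ⊨ hy A ∷ Γ
⊨-hy g (thereH x) = g x

⊨-shiftCtx : ∀ Γ {τ} → τ ⊨ Γ → τ ⊨ shiftCtx Γ
⊨-shiftCtx (pf B ∷ Γ) g here = ⟦⟧-resp-≡ (sym (skeleton-substF _ B)) (g here)
⊨-shiftCtx (pf B ∷ Γ) g (thereP x) = ⊨-shiftCtx Γ (λ y → g (thereP y)) x
⊨-shiftCtx (hy B ∷ Γ) g (thereH x) = ⊨-shiftCtx Γ (λ y → g (thereH y)) x

mutual
  adequacy : ∀ {Γ w A} → Γ ⊢ w ⦂ A → ∀ σ τ → τ ⊨ Γ → ⟦ skeleton A ⟧ (substP τ (substNP σ w))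
  adequacy (ax x) σ τ g = g x
  adequacy (axH _) σ τ g = Hyp-⟦⟧ _
  adequacy (axW _) σ τ g = Wit-⟦⟧ _
  adequacy (∧I {A = A} {B} d e) σ τ g =
    pair-⟦⟧ (skeleton A) (skeleton B) (adequacy d σ τ g) (adequacy e σ τ g)
  adequacy (∧E₀ d) σ τ g = proj₁ (adequacy d σ τ g)
  adequacy (∧E₁ d) σ τ g = proj₂ (adequacy d σ τ g)
  adequacy (⇒E d e) σ τ g = adequacy d σ τ g _ (adequacy e σ τ g)
  adequacy (⇒I {A = A} {B} d) σ τ g = ƛ-⟦⟧ (skeleton A) (skeleton B) (adequacy-↦ d σ τ g)
  adequacy (∨I₀ {A = A} {B} d) σ τ g = inj₀-⟦⟧ (skeleton A) (skeleton B) (adequacy d σ τ g)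
  adequacy (∨I₁ {A = A} {B} d) σ τ g = inj₁-⟦⟧ (skeleton A) (skeleton B) (adequacy d σ τ g)
  adequacy (∨E {A = A} {B} {C} d e₁ e₂) σ τ g = case-⟦⟧ (skeleton A) (skeleton B) (skeleton C)
    (adequacy d σ τ g) (adequacy-↦ e₁ σ τ g) (adequacy-↦ e₂ σ τ g)
  adequacy (∀E {A = A} m d) σ τ g =
    ⟦⟧-resp-≡ (sym (skeleton-substF (single m) A)) (adequacy d σ τ g (substT σ m))
  adequacy (∀I {u} {A} d) σ τ g = Λ-⟦⟧ (skeleton A) λ m →
    subst ⟦ skeleton A ⟧ (sym (Λ-body-subst m σ τ u))
      (adequacy d (substT (single m) ∘ liftS σ) τ (⊨-shiftCtx _ g))
  adequacy (∃I {A = A} m d) σ τ g =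
    ⟪⟫-⟦⟧ (skeleton A) (⟦⟧-resp-≡ (skeleton-substF (single m) A) (adequacy d σ τ g))
  adequacy (∃E {t = t} {A} {C} d e) σ τ g =
    exE-⟦⟧ (skeleton A) (skeleton C) (adequacy d σ τ g) λ n a ra →
    subst ⟦ skeleton C ⟧ (sym (exE-body-subst n σ τ a t))
      (⟦⟧-resp-≡ (skeleton-substF _ C)
        (adequacy e (substT (single n) ∘ liftS σ) (a ∷ₚ τ) (⊨-∷ (⊨-shiftCtx _ g) ra)))
  adequacy (ind {A = A} m d e) σ τ g = ⟦⟧-resp-≡ (sym (skeleton-substF (single m) A))
    (Rec-⟦⟧ (skeleton A) (substT σ m) (⟦⟧-resp-≡ (skeleton-substF (single 𝟎) A) (adequacy d σ τ g))
      (λ n → ⟦⟧-resp-≡ (cong (skeleton A ⇛_) (skeleton-substF stepS A)) (adequacy e σ τ g n)))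
  adequacy (post [] _) σ τ g = sn λ ()
  adequacy (post ds@(_ ∷ _) _) σ τ g = SN-rc (adequacy-atoms ds σ τ g)
  adequacy (nem {C = C} d₁ d₂) σ τ g =
    Em-⟦⟧ (skeleton C) (adequacy d₁ σ τ (⊨-hy g)) (adequacy d₂ σ τ (⊨-hy g))

  adequacy-↦ : ∀ {Γ w A C} → pf A ∷ Γ ⊢ w ⦂ C → ∀ σ τ → τ ⊨ Γ
    → ⟦ skeleton A ↦ skeleton C ⟧ (substP (liftP τ) (substNP σ w))
  adequacy-↦ {w = w} {C = C} d σ τ g a ra =
    subst ⟦ skeleton C ⟧ (sym (liftP-[] a τ (substNP σ w))) (adequacy d σ (a ∷ₚ τ) (⊨-∷ g ra))

  adequacy-atoms : ∀ {Γ us Ps} → Pointwise (λ u Q → Γ ⊢ u ⦂ atm Q) us Ps → ∀ σ τ → τ ⊨ Γ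
    → All SN (substPs τ (substNPs σ us))
  adequacy-atoms [] σ τ g = []
  adequacy-atoms (d ∷ ds) σ τ g = adequacy d σ τ g ∷ adequacy-atoms ds σ τ g

∋-map-hy : ∀ Δ {Γ i B} → (map hy Δ ++ Γ) ∋ i ⦂ B → Γ ∋ i ⦂ B
∋-map-hy [] x = x
∋-map-hy (_ ∷ Δ) (thereH x) = ∋-map-hy Δ x

∋-map-pf : ∀ {n} (As : Vec Fm n) {i B} → map pf (toList As) ∋ i ⦂ B →
           Σ[ p ∈ i < n ] B ≡ lookup As (fromℕ< p)
∋-map-pf (A ∷ As) here = s≤s z≤n , refl
∋-map-pf (A ∷ As) (thereP x) = let p , e = ∋-map-pf As x in s≤s p , e

pfSub-< : ∀ {n} (ts : Vec PT n) {i} (p : i < n) → pfSub ts i ≡ lookup ts (fromℕ< p)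
pfSub-< {n} ts {i} p with i <? n
... | yes _ = refl
... | no ¬p = contradiction p ¬p

pfSub-⊨ : ∀ {n} (As : Vec Fm n) Δ σ (ts : Vec PT n) → (∀ i → lookup ts i ⊩ substF σ (lookup As i))
  → pfSub ts ⊨ ctxOf As Δ
pfSub-⊨ As Δ σ ts hyp x with ∋-map-pf As (∋-map-hy Δ x)
... | p , refl = subst ⟦ skeleton (lookup As (fromℕ< p)) ⟧ (sym (pfSub-< ts p))
  (⟦⟧-resp-≡ (skeleton-substF σ _) (Red⇒⟦⟧ _ vr (hyp (fromℕ< p))))

mainTheorem4 : ∀ {n k : ℕ} (As : Vec Fm n) (Δ : List Fm) (A : Fm) (w : PT)
    → ctxOf As Δ ⊢ w ⦂ A
    → (∀ i → BoundF k (lookup As i)) × All (BoundF k) Δ × BoundF k A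
    → (rs : Vec Tm k) (ts : Vec PT n)
    → (∀ (i : Fin n) → lookup ts i ⊩ substF (numSub rs) (lookup As i))
    → substP (pfSub ts) (substNP (numSub rs) w) ⊩ substF (numSub rs) A
mainTheorem4 As Δ A w d _ rs ts hyp =
  ⟦⟧⇒Red (substF σ A) vr
    (⟦⟧-resp-≡ (sym (skeleton-substF σ A)) (adequacy d σ (pfSub ts) (pfSub-⊨ As Δ σ ts hyp)))
  where
  σ : Sub
  σ = numSub rs
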